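{- Let $D$ be a chord diagram and let $G$ be the ribbon graph associated to $D$, so that the edge-ribbons $E(G)$ are in bijection with the chords of $D$. Then the partial-dual genus polynomial of $G$ satisfies \[ {}^\partial\varepsilon_{G}(z)=\sum_{A\subseteq E(G)} z^{\operatorname{rank}(M_A)+\operatorname{rank}(M_{A^c})}, \] where $A^c=E(G)\setminus A$.
   Context: A chord diagram is an oriented circle with finitely many chords inside it, with pairwise distinct endpoints. The ribbon graph $G$ associated to a chord diagram $D$ is obtained by attaching a disc (the single vertex-disc) to the circle and thickening each chord to an untwisted ribbon (edge-ribbon); $G$ is an orientable ribbon graph with one vertex. For a ribbon graph $G$ with vertex-discs $V(G)$, edge-ribbons $E(G)$, boundary components (face-discs) $F(G)$ and $c(G)$ connected components, its Euler genus is $\varepsilon(G)=2c(G)-|V(G)|+|E(G)|-|F(G)|$. For $A\subseteq E(G)$, the partial dual $G^A$ is defined as follows: let $F_A$ be the ribbon subgraph consisting of all vertex-discs and the edge-ribbons in $A$; glue a disc to each boundary component of $F_A$, and remove the interiors of the original vertex-discs; the result is $G^A$, whose vertex-discs are the glued discs and whose edge set is $E(G)$. The partial-dual genus polynomial is ${}^\partial\varepsilon_G(z)=\sum_{A\subseteq E(G)} z^{\varepsilon(G^A)}$. The intersection graph of a chord diagram has one vertex per chord, two vertices being adjacent iff the corresponding chords intersect. For a set $A$ of chords of $D$, $M_A$ is the adjacency matrix (with entries in $\mathbb{Z}_2$ and zero diagonal) of the intersection graph of the chord diagram obtained from $D$ by deleting all chords not in $A$; $\operatorname{rank}$ denotes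 rank over $\mathbb{Z}_2$, and the rank of the empty ($0\times 0$) matrix is $0$. -}

module Defs where

open import Data.Nat using (ℕ; zero; suc; _+_; _*_; _≤ᵇ_; _<ᵇ_; _⊔_)
open import Data.Nat.DivMod using (_mod_)
open import Data.Fin using (Fin; toℕ) renaming (_≟_ to _≟ᶠ_)
open import Data.Fin.Subset using (Subset; ∁)
open import Data.Bool using (Bool; true; false; _∧_; _∨_; not; _xor_; if_then_else_)
open import Data.List using (List; []; _∷_; map; filter; length; foldr; _++_)
open import Data.Vec using (Vec; []; _∷_; lookup)
open import Data.Integer using (ℤ; +_; _-_) renaming (_+_ to _+ℤ_; _*_ to _*ℤ_)
open import Data.Integer using () renaming (_≟_ to _≟ℤ_)
open import Data.Sum using (_⊎_)
open import Relation.Binary.PropositionalEquality using (_≡_; _≢_)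
open import Relation.Nullary using (does)

allFinL : (m : ℕ) → List (Fin m)
allFinL m = Data.List.allFin m

anyF : ∀ {m} → (Fin m → Bool) → Bool
anyF {m} P = foldr (λ i b → P i ∨ b) false (allFinL m)

allF : ∀ {m} → (Fin m → Bool) → Bool
allF {m} P = foldr (λ i b → P i ∧ b) true (allFinL m)

countF : ∀ {m} → (Fin m → Bool) → ℕ
countF {m} P = length (filter (λ i → P i Data.Bool.≟ true) (allFinL m))

eqF : ∀ {m} → Fin m → Fin m → Bool
eqF i j = does (i ≟ᶠ j)

iter : ∀ {A : Set} → ℕ → (A → A) → A → A
iter zero    f x = x
iter (suc k) f x = f (iter k f x)

-- Orbit counting for permutations of Fin m.
-- i is the representative of its orbit iff it is the least element of
-- {f^k i | k < m} (which is the whole orbit when f is a permutation).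

orbitRep : ∀ {m} → (Fin m → Fin m) → Fin m → Bool
orbitRep {m} f i = allF {m} (λ k → toℕ i ≤ᵇ toℕ (iter (toℕ k) f i))

orbits : ∀ {m} → (Fin m → Fin m) → ℕ
orbits f = countF (orbitRep f)

-- Connected components of the action of the group generated by two
-- permutations σ, α: reach t i = points reachable from i in ≤ t steps.
reach : ∀ {m} → (Fin m → Fin m) → (Fin m → Fin m) → Fin m → ℕ → Fin m → Bool
reach σ α i zero    j = eqF i j
reach σ α i (suc t) j =
  reach σ α i t j ∨ anyF (λ k → reach σ α i t k ∧ (eqF (σ k) j ∨ eqF (α k) j))

orbits₂ : ∀ {m} → (Fin m → Fin m) → (Fin m → Fin m) → ℕ
orbits₂ {m} σ α =
  countF (λ i → allF (λ j → not (reach σ α i m j) ∨ (toℕ i ≤ᵇ toℕ j)))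

-- Orientable ribbon graphs, encoded combinatorially (rotation systems):
-- darts (half-edges) Fin darts, σ = cyclic order of darts around the
-- vertex-discs (following the orientation), α = fixed-point-free
-- involution pairing the two ends of each edge-ribbon.  Vertex-discs
-- with no incident edge (which a rotation system cannot see) are
-- counted separately by `isolated`; each such disc is its own
-- vertex, boundary component and connected component.

record RibbonGraph : Set where
  field
    darts    : ℕ
    isolated : ℕ
    σ        : Fin darts → Fin darts
    α        : Fin darts → Fin darts

module _ (G : RibbonGraph) where
  open RibbonGraph G

  #V : ℕ
  #V = orbits σ + isolated

  #E : ℕ
  #E = orbits α

  #F : ℕ
  #F = orbits (λ p → σ (α p)) + isolated

  #C : ℕ
  #C = orbits₂ σ α + isolated

  eulerGenus : ℤ
  eulerGenus = ((+ 2) *ℤ (+ #C)) - (+ #V) +ℤ (+ #E) - (+ #F)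

  -- Partial dual G^A, for A a set of edges given as an α-invariant set
  -- of darts.  The vertex-discs of G^A are the boundary components of
  -- the spanning subgraph F_A, traced by σ ∘ α_A where α_A crosses the
  -- edge-ribbons in A and fixes the other darts; edges are unchanged.
  partialDual : (Fin darts → Bool) → RibbonGraph
  partialDual A = record
    { darts    = darts
    ; isolated = isolated
    ; σ        = λ p → σ (if A p then α p else p)
    ; α        = α
    }

-- The 2n endpoints are the points
-- 0, 1, …, 2n-1 of Fin (2 * n), listed in the order given by the
-- orientation of the circle.  `chord p` is the chord having p as an
-- endpoint and `partner p` is the other endpoint of that chord.

record ChordDiagram (n : ℕ) : Set where
  field
    chord   : Fin (2 * n) → Fin n
    partner : Fin (2 * n) → Fin (2 * n)
    partner-invol    : ∀ p → partner (partner p) ≡ p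
    partner-distinct : ∀ p → partner p ≢ p
    partner-chord    : ∀ p → chord (partner p) ≡ chord p
    chord-twice      : ∀ p q → chord p ≡ chord q → q ≡ p ⊎ q ≡ partner p

next : ∀ {m} → Fin m → Fin m
next {suc m} i = suc (toℕ i) mod suc m

isZero : ℕ → Bool
isZero zero    = true
isZero (suc _) = false

module _ {n : ℕ} (D : ChordDiagram n) where
  open ChordDiagram D

  -- The ribbon graph associated to D: one vertex-disc whose boundary is
  -- the circle (darts = endpoints, in cyclic order), one untwisted
  -- edge-ribbon per chord.  If n = 0 the vertex-disc is isolated.
  ribbonGraphOf : RibbonGraph
  ribbonGraphOf = record
    { darts    = 2 * n
    ; isolated = if isZero n then 1 else 0
    ; σ        = next
    ; α        = partner
    }

  dartsOf : Subset n → Fin (2 * n) → Bool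
  dartsOf A p = lookup A (chord p)

  strictlyBetween : Fin (2 * n) → Fin (2 * n) → Bool
  strictlyBetween p q =
    ((toℕ p <ᵇ toℕ q) ∧ (toℕ q <ᵇ toℕ (partner p)))
    ∨ ((toℕ (partner p) <ᵇ toℕ q) ∧ (toℕ q <ᵇ toℕ p))

  intersect : Fin n → Fin n → Bool
  intersect c d = anyF (λ p → anyF (λ q →
    eqF (chord p) c ∧ eqF (chord q) d ∧
    (strictlyBetween p q xor strictlyBetween p (partner q))))

allSubsets : (n : ℕ) → List (Subset n)
allSubsets zero    = [] ∷ []
allSubsets (suc n) = map (true ∷_) (allSubsets n) ++ map (false ∷_) (allSubsets n)

_⊆ᵇ_ : ∀ {n} → Subset n → Subset n → Bool
_⊆ᵇ_ {n} S A = allF {n} (λ i → not (lookup S i) ∨ lookup A i)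

nonEmptyᵇ : ∀ {n} → Subset n → Bool
nonEmptyᵇ {n} S = anyF {n} (lookup S)

card : ∀ {n} → Subset n → ℕ
card {n} S = countF {n} (lookup S)

maximumL : List ℕ → ℕ
maximumL = foldr _⊔_ 0

module _ {n : ℕ} (M : Fin n → Fin n → Bool) where

  rowSum : Subset n → Fin n → Bool
  rowSum T j = foldr (λ i b → (lookup T i ∧ M i j) xor b) false (allFinL n)

  independentIn : Subset n → Subset n → Bool
  independentIn A S =
    foldr (λ T b → (not ((T ⊆ᵇ S) ∧ nonEmptyᵇ T)
                     ∨ anyF (λ j → lookup A j ∧ rowSum T j)) ∧ b)
          true (allSubsets n)

  rankOn : Subset n → ℕ
  rankOn A =
    maximumL (map card (filter (λ S → (S ⊆ᵇ A ∧ independentIn A S) Data.Bool.≟ true)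
                                (allSubsets n)))

-- M_A for a chord diagram: adjacency matrix over Z₂ of the intersection
-- graph of the diagram obtained by deleting the chords not in A
-- (deleting chords does not change whether the remaining ones
-- intersect, so this is the principal submatrix on A).
rankM : ∀ {n} → ChordDiagram n → Subset n → ℕ
rankM D A = rankOn (intersect D) A

-- Generating polynomials Σ_{A ⊆ E} z^{f(A)} over subsets of an n-set,
-- represented by their coefficient functions: coeff f k = number of
-- A with f(A) = k.  Two such polynomials are equal iff all
-- coefficients agree.

coeff : ∀ {n} → (Subset n → ℤ) → ℤ → ℕ
coeff {n} f k = length (filter (λ A → f A ≟ℤ k) (allSubsets n))

partialDualGenus : ∀ {n} → ChordDiagram n → Subset n → ℤ
partialDualGenus D A =
  eulerGenus (partialDual (ribbonGraphOf D) (dartsOf D A))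

-- For a set A of chords, the partial dual G^A of the one-vertex ribbon graph G is connected,
-- has one edge per chord, its vertex-discs are the orbits of π_A = next ∘ α_A on the chord
-- ends (α_A swaps the two ends of each chord in A), and its boundary components are the
-- vertex-discs of G^(∁ A). Hence ε(G^A) = 2 + n − v(A) − v(∁ A), and it suffices to show
-- v(A) + rank M_A = 1 + |A|. A π_A-invariant labelling of the ends by bits that vanishes at
-- the first end is the prefix parity of the set X ⊆ A of chords whose two ends it labels
-- differently; conversely the prefix parity of X ⊆ A is π_A-invariant iff every chord of A
-- is crossed by an even number of chords of X, i.e. iff X lies in the kernel of M_A. So the
-- invariant labellings number 2^v(A) = 2 · |ker M_A| = 2 · 2^(|A| − rank M_A), the last step
-- because a maximum independent set of rows spans all the rows.

module Submission where

open import Defs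
open import Algebra.Bundles using (CommutativeRing)
import Algebra.Properties.CommutativeSemigroup as CommutativeSemigroupProperties
import Algebra.Properties.Semiring.Sum as SemiringSum
open import Data.Bool using (Bool; true; false; _∧_; _∨_; not; _xor_; if_then_else_; T)
import Data.Bool as Bool
open import Data.Bool.Properties
  using (xor-∧-commutativeRing; ∧-comm; ∧-assoc; ∧-zeroʳ; ∧-identityʳ; ∧-distribʳ-xor; ∨-comm; ∨-zeroʳ;
         ∨-identityʳ; xor-comm; xor-identityʳ; xor-same; xor-annihilates-not; not-involutive; not-injective;
         ∧-conicalˡ; ∧-conicalʳ; T-≡)
open import Data.Fin using (Fin; zero; suc; toℕ; fromℕ<)
import Data.Fin as Fin
open import Data.Fin.Properties using (toℕ-injective; toℕ<n; toℕ≤pred[n]; toℕ-fromℕ<; pigeonhole)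
open import Data.Fin.Subset using (Subset; ∁)
open import Data.Integer using (ℤ; +_) renaming (_+_ to _+ℤ_; _-_ to _-ℤ_; _*_ to _*ℤ_)
import Data.Integer.Properties as ℤ
open import Data.Integer.Tactic.RingSolver using (solve-∀)
open import Data.List as List using (List; []; _∷_; filter; length; map)
open import Data.List.Extrema.Nat using (argmin; argmin-all; f[argmin]≤f[xs]; f[argmin]≤f[⊤])
open import Data.List.Membership.Propositional using (_∈_)
open import Data.List.Membership.Propositional.Properties
  using (∈-tabulate⁺; ∈-tabulate⁻; ∈-++⁺ˡ; ∈-++⁺ʳ; ∈-map⁺; ∈-map⁻; ∈-filter⁺; ∈-filter⁻)
open import Data.List.Properties using (filter-≐)
import Data.List.Relation.Unary.All as All
open import Data.List.Relation.Unary.Any using (here; there)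
open import Data.Nat using (ℕ; zero; suc; _+_; _*_; _∸_; _^_; _≤_; _<_; _≤ᵇ_; _<ᵇ_; z≤n; s≤s; z<s)
open import Data.Nat.DivMod using (_%_; _/_; m≡m%n+[m/n]*n; m%n<n; m<n⇒m%n≡m; n%n≡0)
open import Data.Nat.Properties
open import Data.Product using (∃; _×_; _,_; proj₁; proj₂)
open import Data.Sum using (_⊎_; inj₁; inj₂)
open import Data.Vec using (Vec; []; _∷_; lookup; tabulate; replicate)
open import Data.Vec.Properties
  using (≡-dec; lookup∘tabulate; tabulate-cong; tabulate∘lookup; lookup-replicate; lookup-map)
import Data.Vec.Functional as Vector
open import Function using (_∘_)
open import Function.Bundles using (Equivalence)
open import Function.Definitions using (Injective)
open import Relation.Binary.Definitions using (tri<; tri≈; tri>)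
open import Relation.Binary.PropositionalEquality
open import Relation.Nullary using (Dec; does; yes; no; contradiction)
open import Relation.Nullary.Decidable using (dec-true; dec-false)

open CommutativeSemigroupProperties +-commutativeSemigroup
  using () renaming (interchange to +-interchange)
open CommutativeSemigroupProperties (CommutativeRing.+-commutativeSemigroup xor-∧-commutativeRing)
  using () renaming (interchange to xor-interchange)

𝟙 : Bool → ℕ
𝟙 true  = 1
𝟙 false = 0

𝟙-∧ : ∀ a b → 𝟙 (a ∧ b) ≡ 𝟙 a * 𝟙 b
𝟙-∧ true  b = sym (+-identityʳ (𝟙 b))
𝟙-∧ false b = refl

module ℕ-Sum = SemiringSum +-*-semiring
module 𝔽₂-Sum = SemiringSum (CommutativeRing.semiring xor-∧-commutativeRing)

∑ : ∀ {m} → (Fin m → ℕ) → ℕ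
∑ = ℕ-Sum.sum

⨁ : ∀ {m} → (Fin m → Bool) → Bool
⨁ = 𝔽₂-Sum.sum

∑-const : ∀ {m} c → ∑ {m} (λ _ → c) ≡ m * c
∑-const {zero}  c = refl
∑-const {suc m} c = cong (λ x → c + x) (∑-const {m} c)

∑-mono-≤ : ∀ {m} {f g : Fin m → ℕ} → (∀ i → f i ≤ g i) → ∑ f ≤ ∑ g
∑-mono-≤ {zero}  h = z≤n
∑-mono-≤ {suc m} h = +-mono-≤ (h zero) (∑-mono-≤ (h ∘ suc))

∑-select : ∀ {m} (a : Fin m) (f : Fin m → ℕ) → ∑ (λ i → 𝟙 (eqF i a) * f i) ≡ f a
∑-select {suc m} zero f = begin
  f zero + 0 + ∑ {m} (λ _ → 0)  ≡⟨ cong₂ _+_ (+-identityʳ (f zero)) (ℕ-Sum.sum-replicate-zero m) ⟩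
  f zero + 0                     ≡⟨ +-identityʳ (f zero) ⟩
  f zero                         ∎
  where open ≡-Reasoning
∑-select {suc m} (suc a) f = ∑-select a (f ∘ suc)

∑-indicator : ∀ {m} (a : Fin m) → ∑ (λ i → 𝟙 (eqF i a)) ≡ 1
∑-indicator a = trans (ℕ-Sum.sum-cong-≗ (λ i → sym (*-identityʳ (𝟙 (eqF i a))))) (∑-select a (λ _ → 1))

⨁-select : ∀ {m} (a : Fin m) (f : Fin m → Bool) → ⨁ (λ i → eqF i a ∧ f i) ≡ f a
⨁-select {suc m} zero f = trans (cong (f zero xor_) (𝔽₂-Sum.sum-replicate-zero m)) (xor-identityʳ (f zero))
⨁-select {suc m} (suc a) f = ⨁-select a (f ∘ suc)

⨁-zero : ∀ {m} {f : Fin m → Bool} → (∀ i → f i ≡ false) → ⨁ f ≡ false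
⨁-zero {m} h = trans (𝔽₂-Sum.sum-cong-≗ h) (𝔽₂-Sum.sum-replicate-zero m)

2^-injective : ∀ {a b} → 2 ^ a ≡ 2 ^ b → a ≡ b
2^-injective {a} {b} eq with <-cmp a b
... | tri< a<b _ _ = contradiction eq (<⇒≢ (^-monoʳ-< 2 (s≤s (s≤s z≤n)) a<b))
... | tri≈ _ a≡b _ = a≡b
... | tri> _ _ a>b = contradiction (sym eq) (<⇒≢ (^-monoʳ-< 2 (s≤s (s≤s z≤n)) a>b))

T⇒≡true : ∀ {b} → T b → b ≡ true
T⇒≡true = Equivalence.to T-≡

≡true⇒T : ∀ {b} → b ≡ true → T b
≡true⇒T = Equivalence.from T-≡

foldr-tabulate : ∀ {A B C : Set} (f : B → C → C) (g : A → B) (e : C) {m} (h : Fin m → A) →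
  List.foldr (λ x c → f (g x) c) e (List.tabulate h) ≡ Vector.foldr f e (g ∘ h)
foldr-tabulate f g e {zero}  h = refl
foldr-tabulate f g e {suc m} h = cong (f (g (h zero))) (foldr-tabulate f g e (h ∘ suc))

allF≡foldr : ∀ {m} (P : Fin m → Bool) → allF P ≡ Vector.foldr _∧_ true P
allF≡foldr P = foldr-tabulate _∧_ P true (λ i → i)

anyF≡foldr : ∀ {m} (P : Fin m → Bool) → anyF P ≡ Vector.foldr _∨_ false P
anyF≡foldr P = foldr-tabulate _∨_ P false (λ i → i)

length-filter : ∀ {A : Set} (P : A → Bool) (xs : List A) →
  length (filter (λ x → P x Bool.≟ true) xs) ≡ List.foldr (λ x k → 𝟙 (P x) + k) 0 xs
length-filter P []       = refl
length-filter P (x ∷ xs) with P x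
... | true  = cong suc (length-filter P xs)
... | false = length-filter P xs

countF≡∑ : ∀ {m} (P : Fin m → Bool) → countF P ≡ ∑ (𝟙 ∘ P)
countF≡∑ {m} P = trans (length-filter P (allFinL m)) (foldr-tabulate _+_ (𝟙 ∘ P) 0 (λ i → i))

countF-cong : ∀ {m} (P Q : Fin m → Bool) → (∀ i → P i ≡ Q i) → countF P ≡ countF Q
countF-cong P Q h = trans (countF≡∑ P) (trans (ℕ-Sum.sum-cong-≗ (λ i → cong 𝟙 (h i))) (sym (countF≡∑ Q)))

rowSum≡⨁ : ∀ {n} (M : Fin n → Fin n → Bool) (T : Subset n) (j : Fin n) →
  rowSum M T j ≡ ⨁ (λ i → lookup T i ∧ M i j)
rowSum≡⨁ M T j = foldr-tabulate _xor_ (λ i → lookup T i ∧ M i j) false (λ i → i)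

allF-suc : ∀ {m} (P : Fin (suc m) → Bool) → allF P ≡ P zero ∧ allF (P ∘ suc)
allF-suc P = trans (allF≡foldr P) (cong (P zero ∧_) (sym (allF≡foldr (P ∘ suc))))

allF-true⁺ : ∀ {m} (P : Fin m → Bool) → (∀ i → P i ≡ true) → allF P ≡ true
allF-true⁺ {zero}  P h = refl
allF-true⁺ {suc m} P h rewrite allF-suc P | h zero = allF-true⁺ (P ∘ suc) (h ∘ suc)

allF-true⁻ : ∀ {m} (P : Fin m → Bool) → allF P ≡ true → ∀ i → P i ≡ true
allF-true⁻ {suc m} P h i rewrite allF-suc P with P zero in P₀ | i
... | true | zero  = P₀
... | true | suc i = allF-true⁻ (P ∘ suc) h i

allF-false⁺ : ∀ {m} (P : Fin m → Bool) i → P i ≡ false → allF P ≡ false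
allF-false⁺ P i Pᵢ with allF P in all-P
... | false = refl
... | true  = trans (sym (allF-true⁻ P all-P i)) Pᵢ

allF-cong : ∀ {m} (P Q : Fin m → Bool) → (∀ i → P i ≡ Q i) → allF P ≡ allF Q
allF-cong {zero}  P Q h = refl
allF-cong {suc m} P Q h =
  trans (allF-suc P) (trans (cong₂ _∧_ (h zero) (allF-cong (P ∘ suc) (Q ∘ suc) (h ∘ suc))) (sym (allF-suc Q)))

anyF-suc : ∀ {m} (P : Fin (suc m) → Bool) → anyF P ≡ P zero ∨ anyF (P ∘ suc)
anyF-suc P = trans (anyF≡foldr P) (cong (P zero ∨_) (sym (anyF≡foldr (P ∘ suc))))

anyF-true⁺ : ∀ {m} (P : Fin m → Bool) i → P i ≡ true → anyF P ≡ true
anyF-true⁺ P zero    h rewrite anyF-suc P | h = refl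
anyF-true⁺ P (suc i) h rewrite anyF-suc P | anyF-true⁺ (P ∘ suc) i h = ∨-zeroʳ (P zero)

anyF-true⁻ : ∀ {m} (P : Fin m → Bool) → anyF P ≡ true → ∃ λ i → P i ≡ true
anyF-true⁻ {suc m} P h rewrite anyF-suc P with P zero in P₀
... | true  = zero , P₀
... | false with anyF-true⁻ (P ∘ suc) h
...   | i , Pi = suc i , Pi

anyF-false⁺ : ∀ {m} (P : Fin m → Bool) → (∀ i → P i ≡ false) → anyF P ≡ false
anyF-false⁺ {zero}  P h = refl
anyF-false⁺ {suc m} P h rewrite anyF-suc P | h zero = anyF-false⁺ (P ∘ suc) (h ∘ suc)

anyF-false⁻ : ∀ {m} (P : Fin m → Bool) → anyF P ≡ false → ∀ i → P i ≡ false
anyF-false⁻ P h i with P i in Pi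
... | false = refl
... | true  = trans (sym (anyF-true⁺ P i Pi)) h

anyF-cong : ∀ {m} (P Q : Fin m → Bool) → (∀ i → P i ≡ Q i) → anyF P ≡ anyF Q
anyF-cong {zero}  P Q h = refl
anyF-cong {suc m} P Q h =
  trans (anyF-suc P) (trans (cong₂ _∨_ (h zero) (anyF-cong (P ∘ suc) (Q ∘ suc) (h ∘ suc))) (sym (anyF-suc Q)))

anyF-∧ˡ : ∀ {m} a (G : Fin m → Bool) → anyF (λ i → a ∧ G i) ≡ a ∧ anyF G
anyF-∧ˡ true  G = refl
anyF-∧ˡ {m} false G = anyF-false⁺ {m} (λ _ → false) (λ _ → refl)

true≢false : true ≢ false
true≢false ()

∧-true⁻ : ∀ {a b} → (a ∧ b) ≡ true → a ≡ true × b ≡ true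
∧-true⁻ {a} {b} h = ∧-conicalˡ a b h , ∧-conicalʳ a b h

xor-cancel : ∀ {a b} → (a xor b) ≡ false → a ≡ b
xor-cancel {true}  {true}  _ = refl
xor-cancel {false} {false} _ = refl


eqF-sym : ∀ {m} (a b : Fin m) → eqF a b ≡ eqF b a
eqF-sym zero    zero    = refl
eqF-sym zero    (suc b) = refl
eqF-sym (suc a) zero    = refl
eqF-sym (suc a) (suc b) = eqF-sym a b

eqF-true⁺ : ∀ {m} {a b : Fin m} → a ≡ b → eqF a b ≡ true
eqF-true⁺ {a = a} {b} = dec-true (a Fin.≟ b)

eqF-refl : ∀ {m} (i : Fin m) → eqF i i ≡ true
eqF-refl i = eqF-true⁺ {a = i} refl

eqF-true⁻ : ∀ {m} {i j : Fin m} → eqF i j ≡ true → i ≡ j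
eqF-true⁻ {i = zero}  {zero}  _ = refl
eqF-true⁻ {i = suc i} {suc j} h = cong suc (eqF-true⁻ h)

eqF-false⁺ : ∀ {m} {a b : Fin m} → a ≢ b → eqF a b ≡ false
eqF-false⁺ {a = a} {b} = dec-false (a Fin.≟ b)

toℕ-≢ : ∀ {k} {a b : Fin k} → a ≢ b → toℕ a ≢ toℕ b
toℕ-≢ a≢b = a≢b ∘ toℕ-injective

tabulate-≡ : ∀ {A : Set} {k} {f : Fin k → A} {xs : Vec A k} → (∀ i → f i ≡ lookup xs i) → tabulate f ≡ xs
tabulate-≡ {xs = xs} h = trans (tabulate-cong h) (tabulate∘lookup xs)

lookup-ext : ∀ {A : Set} {k} {xs ys : Vec A k} → (∀ i → lookup xs i ≡ lookup ys i) → xs ≡ ys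
lookup-ext {xs = xs} h = trans (sym (tabulate∘lookup xs)) (tabulate-≡ h)

infix 4 _⊆ˢ_
_⊆ˢ_ : ∀ {k} → Subset k → Subset k → Set
S ⊆ˢ R = ∀ i → lookup S i ≡ true → lookup R i ≡ true

⊆ᵇ⁺ : ∀ {k} (S R : Subset k) → S ⊆ˢ R → (S ⊆ᵇ R) ≡ true
⊆ᵇ⁺ S R S⊆R = allF-true⁺ _ λ i → implication (lookup S i) (S⊆R i)
  where
  implication : ∀ a {b} → (a ≡ true → b ≡ true) → (not a ∨ b) ≡ true
  implication false h = refl
  implication true  h = h refl

⊆ᵇ⁻ : ∀ {k} (S R : Subset k) → (S ⊆ᵇ R) ≡ true → S ⊆ˢ R
⊆ᵇ⁻ S R h i = modus-ponens (lookup S i) (allF-true⁻ _ h i)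
  where
  modus-ponens : ∀ a {b} → (not a ∨ b) ≡ true → a ≡ true → b ≡ true
  modus-ponens true b≡true refl = b≡true

⊆ˢ-∉ : ∀ {k} (S R : Subset k) → S ⊆ˢ R → ∀ i → lookup R i ≡ false → lookup S i ≡ false
⊆ˢ-∉ S R S⊆R i Rᵢ with lookup S i in Sᵢ
... | false = refl
... | true  = trans (sym (S⊆R i Sᵢ)) Rᵢ

⊆ᵇ-∷ : ∀ {k} a b (S R : Subset k) → ((a ∷ S) ⊆ᵇ (b ∷ R)) ≡ (not a ∨ b) ∧ (S ⊆ᵇ R)
⊆ᵇ-∷ a b S R = allF-suc (λ i → not (lookup (a ∷ S) i) ∨ lookup (b ∷ R) i)

card≡∑ : ∀ {k} (S : Subset k) → card S ≡ ∑ (𝟙 ∘ lookup S)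
card≡∑ S = countF≡∑ (lookup S)

card-∷ : ∀ {k} b (S : Subset k) → card (b ∷ S) ≡ 𝟙 b + card S
card-∷ b S = trans (card≡∑ (b ∷ S)) (cong (λ x → 𝟙 b + x) (sym (card≡∑ S)))

lookup-∁ : ∀ {k} (S : Subset k) i → lookup (∁ S) i ≡ not (lookup S i)
lookup-∁ S i = lookup-map i not S

∁-involutive : ∀ {k} (S : Subset k) → ∁ (∁ S) ≡ S
∁-involutive S = lookup-ext λ i → trans (lookup-∁ (∁ S) i) (trans (cong not (lookup-∁ S i)) (not-involutive (lookup S i)))

∅ : ∀ {k} → Subset k
∅ = replicate _ false

⁅_⁆ : ∀ {k} → Fin k → Subset k
⁅ i ⁆ = tabulate (λ k → eqF k i)

infixl 6 _∖_ _△_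
infixl 7 _∩_

_∩_ _∖_ _△_ : ∀ {k} → Subset k → Subset k → Subset k
S ∩ R = tabulate (λ i → lookup S i ∧ lookup R i)
S ∖ R = tabulate (λ i → lookup S i ∧ not (lookup R i))
S △ R = tabulate (λ i → lookup S i xor lookup R i)

insert : ∀ {k} → Subset k → Fin k → Subset k
insert S i = tabulate (λ k → lookup S k ∨ eqF k i)

lookup-insert-≢ : ∀ {k} (S : Subset k) {i l} → eqF l i ≡ false → lookup (insert S i) l ≡ lookup S l
lookup-insert-≢ S {i} {l} l≢i = trans (lookup∘tabulate _ l) (trans (cong (lookup S l ∨_) l≢i) (∨-identityʳ (lookup S l)))

lookup-∖⁅⁆ : ∀ {k} (S : Subset k) i l → lookup (S ∖ ⁅ i ⁆) l ≡ lookup S l ∧ not (eqF l i)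
lookup-∖⁅⁆ S i l = trans (lookup∘tabulate _ l) (cong (λ b → lookup S l ∧ not b) (lookup∘tabulate _ l))

∅-⊆ : ∀ {k} (S : Subset k) → ∅ ⊆ˢ S
∅-⊆ S i ∅ᵢ = contradiction (trans (sym (lookup-replicate i false)) ∅ᵢ) λ ()

card-insert : ∀ {k} (S : Subset k) i → lookup S i ≡ false → card (insert S i) ≡ suc (card S)
card-insert S i Sᵢ = begin
  card (insert S i)                             ≡⟨ card≡∑ (insert S i) ⟩
  ∑ (λ k → 𝟙 (lookup (insert S i) k))
    ≡⟨ ℕ-Sum.sum-cong-≗ (λ k → trans (cong 𝟙 (lookup∘tabulate _ k)) (𝟙-∨ (lookup S k) (eqF k i) (disjoint k))) ⟩
  ∑ (λ k → 𝟙 (lookup S k) + 𝟙 (eqF k i))        ≡⟨ ℕ-Sum.∑-distrib-+ (𝟙 ∘ lookup S) _ ⟩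
  ∑ (𝟙 ∘ lookup S) + ∑ (λ k → 𝟙 (eqF k i))      ≡⟨ cong₂ _+_ (sym (card≡∑ S)) (∑-indicator i) ⟩
  card S + 1                                    ≡⟨ +-comm (card S) 1 ⟩
  suc (card S)                                  ∎
  where
  open ≡-Reasoning
  𝟙-∨ : ∀ a b → (a ∧ b) ≡ false → 𝟙 (a ∨ b) ≡ 𝟙 a + 𝟙 b
  𝟙-∨ true  false _ = refl
  𝟙-∨ false b     _ = refl
  disjoint : ∀ k → (lookup S k ∧ eqF k i) ≡ false
  disjoint k with eqF k i in k≡i
  ... | false = ∧-zeroʳ _
  ... | true  = trans (∧-identityʳ _) (trans (cong (lookup S) (eqF-true⁻ k≡i)) Sᵢ)

card-∖+card : ∀ {k} (A B : Subset k) → B ⊆ˢ A → card (A ∖ B) + card B ≡ card A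
card-∖+card A B B⊆A = begin
  card (A ∖ B) + card B                         ≡⟨ cong₂ _+_ (card≡∑ (A ∖ B)) (card≡∑ B) ⟩
  ∑ (𝟙 ∘ lookup (A ∖ B)) + ∑ (𝟙 ∘ lookup B)     ≡⟨ ℕ-Sum.∑-distrib-+ (𝟙 ∘ lookup (A ∖ B)) _ ⟨
  ∑ (λ i → 𝟙 (lookup (A ∖ B) i) + 𝟙 (lookup B i))
    ≡⟨ ℕ-Sum.sum-cong-≗ (λ i → trans (cong (λ b → 𝟙 b + 𝟙 (lookup B i)) (lookup∘tabulate _ i)) (split i)) ⟩
  ∑ (𝟙 ∘ lookup A)                              ≡⟨ card≡∑ A ⟨
  card A                                        ∎
  where
  open ≡-Reasoning
  split : ∀ i → 𝟙 (lookup A i ∧ not (lookup B i)) + 𝟙 (lookup B i) ≡ 𝟙 (lookup A i)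
  split i with lookup B i in Bᵢ
  ... | true  rewrite B⊆A i Bᵢ = refl
  ... | false rewrite ∧-identityʳ (lookup A i) = +-identityʳ _

card+card-∁ : ∀ {k} (A : Subset k) → card A + card (∁ A) ≡ k
card+card-∁ {k} A = begin
  card A + card (∁ A)                              ≡⟨ cong₂ _+_ (card≡∑ A) (card≡∑ (∁ A)) ⟩
  ∑ (𝟙 ∘ lookup A) + ∑ (𝟙 ∘ lookup (∁ A))          ≡⟨ ℕ-Sum.∑-distrib-+ (𝟙 ∘ lookup A) _ ⟨
  ∑ (λ i → 𝟙 (lookup A i) + 𝟙 (lookup (∁ A) i))
    ≡⟨ ℕ-Sum.sum-cong-≗ (λ i → trans (cong (λ b → 𝟙 (lookup A i) + 𝟙 b) (lookup-∁ A i)) (one (lookup A i))) ⟩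
  ∑ {k} (λ _ → 1)                                  ≡⟨ ∑-const {k} 1 ⟩
  k * 1                                            ≡⟨ *-identityʳ k ⟩
  k                                                ∎
  where
  open ≡-Reasoning
  one : ∀ b → 𝟙 b + 𝟙 (not b) ≡ 1
  one true  = refl
  one false = refl

∑ˢ : ∀ {k} → (Subset k → ℕ) → ℕ
∑ˢ {zero}  f = f []
∑ˢ {suc k} f = ∑ˢ (f ∘ (true ∷_)) + ∑ˢ (f ∘ (false ∷_))

#ˢ : ∀ {k} → (Subset k → Bool) → ℕ
#ˢ P = ∑ˢ (𝟙 ∘ P)

∑ˢ-cong : ∀ {k} {f g : Subset k → ℕ} → (∀ S → f S ≡ g S) → ∑ˢ f ≡ ∑ˢ g
∑ˢ-cong {zero}  h = h []
∑ˢ-cong {suc k} h = cong₂ _+_ (∑ˢ-cong (h ∘ (true ∷_))) (∑ˢ-cong (h ∘ (false ∷_)))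

∑ˢ-zero : ∀ {k} → ∑ˢ {k} (λ _ → 0) ≡ 0
∑ˢ-zero {zero}  = refl
∑ˢ-zero {suc k} = cong₂ _+_ (∑ˢ-zero {k}) (∑ˢ-zero {k})

∑ˢ-distrib-+ : ∀ {k} (f g : Subset k → ℕ) → ∑ˢ (λ S → f S + g S) ≡ ∑ˢ f + ∑ˢ g
∑ˢ-distrib-+ {zero}  f g = refl
∑ˢ-distrib-+ {suc k} f g = begin
  ∑ˢ (λ S → f (true ∷ S) + g (true ∷ S)) + ∑ˢ (λ S → f (false ∷ S) + g (false ∷ S))
    ≡⟨ cong₂ _+_ (∑ˢ-distrib-+ (f ∘ (true ∷_)) (g ∘ (true ∷_))) (∑ˢ-distrib-+ (f ∘ (false ∷_)) (g ∘ (false ∷_))) ⟩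
  (∑ˢ (f ∘ (true ∷_)) + ∑ˢ (g ∘ (true ∷_))) + (∑ˢ (f ∘ (false ∷_)) + ∑ˢ (g ∘ (false ∷_)))
    ≡⟨ +-interchange (∑ˢ (f ∘ (true ∷_))) _ _ _ ⟩
  ∑ˢ f + ∑ˢ g ∎
  where open ≡-Reasoning

*-distribˡ-∑ˢ : ∀ {k} c (f : Subset k → ℕ) → c * ∑ˢ f ≡ ∑ˢ (λ S → c * f S)
*-distribˡ-∑ˢ {zero}  c f = refl
*-distribˡ-∑ˢ {suc k} c f =
  trans (*-distribˡ-+ c (∑ˢ (f ∘ (true ∷_))) _)
        (cong₂ _+_ (*-distribˡ-∑ˢ c (f ∘ (true ∷_))) (*-distribˡ-∑ˢ c (f ∘ (false ∷_))))

∑ˢ-comm : ∀ {k l} (h : Subset k → Subset l → ℕ) →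
  ∑ˢ (λ S → ∑ˢ (λ T → h S T)) ≡ ∑ˢ (λ T → ∑ˢ (λ S → h S T))
∑ˢ-comm {zero}  h = refl
∑ˢ-comm {suc k} h = begin
  ∑ˢ (λ S → ∑ˢ (h (true ∷ S))) + ∑ˢ (λ S → ∑ˢ (h (false ∷ S)))
    ≡⟨ cong₂ _+_ (∑ˢ-comm (h ∘ (true ∷_))) (∑ˢ-comm (h ∘ (false ∷_))) ⟩
  ∑ˢ (λ T → ∑ˢ (λ S → h (true ∷ S) T)) + ∑ˢ (λ T → ∑ˢ (λ S → h (false ∷ S) T))
    ≡⟨ ∑ˢ-distrib-+ (λ T → ∑ˢ (λ S → h (true ∷ S) T)) _ ⟨
  ∑ˢ (λ T → ∑ˢ (λ S → h S T)) ∎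
  where open ≡-Reasoning

infix 4 _≟ˢ_
_≟ˢ_ : ∀ {k} (S T : Subset k) → Dec (S ≡ T)
_≟ˢ_ = ≡-dec Bool._≟_

#ˢ-≡ : ∀ {k} (T : Subset k) → #ˢ (λ S → does (S ≟ˢ T)) ≡ 1
#ˢ-≡ []          = refl
#ˢ-≡ {suc k} (true ∷ T)  = trans (cong₂ _+_ (#ˢ-≡ T) (∑ˢ-zero {k})) refl
#ˢ-≡ {suc k} (false ∷ T) = cong₂ _+_ (∑ˢ-zero {k}) (#ˢ-≡ T)

#ˢ-split : ∀ {k} (P Q : Subset k → Bool) →
  #ˢ P ≡ #ˢ (λ S → P S ∧ Q S) + #ˢ (λ S → P S ∧ not (Q S))
#ˢ-split P Q = trans (∑ˢ-cong (λ S → split (P S) (Q S)))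
                     (∑ˢ-distrib-+ (λ S → 𝟙 (P S ∧ Q S)) (λ S → 𝟙 (P S ∧ not (Q S))))
  where
  split : ∀ a b → 𝟙 a ≡ 𝟙 (a ∧ b) + 𝟙 (a ∧ not b)
  split true  true  = refl
  split true  false = refl
  split false b     = refl

record _≅ˢ_ {k l} (P : Subset k → Bool) (Q : Subset l → Bool) : Set where
  field
    to      : Subset k → Subset l
    from    : Subset l → Subset k
    to-∈    : ∀ {S} → P S ≡ true → Q (to S) ≡ true
    from-∈  : ∀ {T} → Q T ≡ true → P (from T) ≡ true
    from∘to : ∀ {S} → P S ≡ true → from (to S) ≡ S
    to∘from : ∀ {T} → Q T ≡ true → to (from T) ≡ T

#ˢ-as-double-sum : ∀ {k l} (P : Subset k → Bool) (f : Subset k → Subset l) →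
  #ˢ P ≡ ∑ˢ (λ S → ∑ˢ (λ T → 𝟙 (P S ∧ does (T ≟ˢ f S))))
#ˢ-as-double-sum {l = l} P f = ∑ˢ-cong λ S → begin
  𝟙 (P S)                                   ≡⟨ *-identityʳ (𝟙 (P S)) ⟨
  𝟙 (P S) * 1                               ≡⟨ cong (𝟙 (P S) *_) (#ˢ-≡ (f S)) ⟨
  𝟙 (P S) * #ˢ (λ T → does (T ≟ˢ f S))      ≡⟨ *-distribˡ-∑ˢ {l} (𝟙 (P S)) _ ⟩
  ∑ˢ (λ T → 𝟙 (P S) * 𝟙 (does (T ≟ˢ f S)))  ≡⟨ ∑ˢ-cong {l} (λ T → 𝟙-∧ (P S) _) ⟨
  ∑ˢ (λ T → 𝟙 (P S ∧ does (T ≟ˢ f S)))      ∎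
  where open ≡-Reasoning

#ˢ-cong-≅ : ∀ {k l} {P : Subset k → Bool} {Q : Subset l → Bool} → P ≅ˢ Q → #ˢ P ≡ #ˢ Q
#ˢ-cong-≅ {P = P} {Q} P≅Q = begin
  #ˢ P                                                   ≡⟨ #ˢ-as-double-sum P to ⟩
  ∑ˢ (λ S → ∑ˢ (λ T → 𝟙 (P S ∧ does (T ≟ˢ to S))))      ≡⟨ ∑ˢ-comm (λ S T → 𝟙 (P S ∧ does (T ≟ˢ to S))) ⟩
  ∑ˢ (λ T → ∑ˢ (λ S → 𝟙 (P S ∧ does (T ≟ˢ to S))))      ≡⟨ ∑ˢ-cong (λ T → ∑ˢ-cong (λ S → cong 𝟙 (graph S T))) ⟩
  ∑ˢ (λ T → ∑ˢ (λ S → 𝟙 (Q T ∧ does (S ≟ˢ from T))))    ≡⟨ #ˢ-as-double-sum Q from ⟨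
  #ˢ Q                                                   ∎
  where
  open ≡-Reasoning
  open _≅ˢ_ P≅Q
  graph : ∀ S T → (P S ∧ does (T ≟ˢ to S)) ≡ (Q T ∧ does (S ≟ˢ from T))
  graph S T with P S in PS | Q T in QT
  ... | false | false = refl
  ... | true  | false = dec-false (T ≟ˢ to S) λ { refl → true≢false (trans (sym (to-∈ PS)) QT) }
  ... | false | true  = sym (dec-false (S ≟ˢ from T) λ { refl → true≢false (trans (sym (from-∈ QT)) PS) })
  ... | true  | true with T ≟ˢ to S | S ≟ˢ from T
  ...   | yes _    | yes _    = refl
  ...   | no _     | no _     = refl
  ...   | yes refl | no S≢    = contradiction (sym (from∘to PS)) S≢
  ...   | no T≢    | yes refl = contradiction (sym (to∘from QT)) T≢

#ˢ-⊆ : ∀ {k} (R : Subset k) → #ˢ (_⊆ᵇ R) ≡ 2 ^ card R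
#ˢ-⊆ [] = refl
#ˢ-⊆ {suc k} (b ∷ R) = begin
  #ˢ (λ S → (true ∷ S) ⊆ᵇ (b ∷ R)) + #ˢ (λ S → (false ∷ S) ⊆ᵇ (b ∷ R))
    ≡⟨ cong₂ _+_ (∑ˢ-cong (λ S → cong 𝟙 (⊆ᵇ-∷ true b S R))) (∑ˢ-cong (λ S → cong 𝟙 (⊆ᵇ-∷ false b S R))) ⟩
  #ˢ (λ S → b ∧ (S ⊆ᵇ R)) + #ˢ (_⊆ᵇ R)
    ≡⟨ cong₂ _+_ (extra b) (#ˢ-⊆ R) ⟩
  𝟙 b * 2 ^ card R + 2 ^ card R
    ≡⟨ doubling b (2 ^ card R) ⟩
  2 ^ 𝟙 b * 2 ^ card R
    ≡⟨ ^-distribˡ-+-* 2 (𝟙 b) (card R) ⟨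
  2 ^ (𝟙 b + card R)
    ≡⟨ cong (2 ^_) (card-∷ b R) ⟨
  2 ^ card (b ∷ R) ∎
  where
  open ≡-Reasoning
  extra : ∀ b → #ˢ (λ S → b ∧ (S ⊆ᵇ R)) ≡ 𝟙 b * 2 ^ card R
  extra true  = trans (#ˢ-⊆ R) (sym (+-identityʳ (2 ^ card R)))
  extra false = ∑ˢ-zero {k}
  doubling : ∀ b x → 𝟙 b * x + x ≡ 2 ^ 𝟙 b * x
  doubling true  x = +-comm (1 * x) x
  doubling false x = sym (+-identityʳ x)

#ˢ-all : ∀ {k} → #ˢ {k} (λ _ → true) ≡ 2 ^ k
#ˢ-all {zero}  = refl
#ˢ-all {suc k} = trans (cong₂ _+_ (#ˢ-all {k}) (#ˢ-all {k})) (cong (λ x → 2 ^ k + x) (sym (+-identityʳ (2 ^ k))))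

-- Orbits of a permutation

iter-+ : ∀ {A : Set} (f : A → A) a b x → iter (a + b) f x ≡ iter a f (iter b f x)
iter-+ f zero    b x = refl
iter-+ f (suc a) b x = cong f (iter-+ f a b x)

iter-periodic : ∀ {A : Set} (f : A → A) p x → iter p f x ≡ x → ∀ c → iter (c * p) f x ≡ x
iter-periodic f p x fᵖx≡x zero    = refl
iter-periodic f p x fᵖx≡x (suc c) =
  trans (iter-+ f p (c * p) x) (trans (cong (iter p f) (iter-periodic f p x fᵖx≡x c)) fᵖx≡x)

iter-cong : ∀ {A : Set} {f g : A → A} → (∀ x → f x ≡ g x) → ∀ k x → iter k f x ≡ iter k g x
iter-cong f≗g zero    x = refl
iter-cong {f = f} f≗g (suc k) x = trans (cong f (iter-cong f≗g k x)) (f≗g _)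

orbits-cong : ∀ {m} (f g : Fin m → Fin m) → (∀ x → f x ≡ g x) → orbits f ≡ orbits g
orbits-cong {m} f g f≗g = countF-cong (orbitRep f) (orbitRep g) λ i →
  allF-cong (λ (k : Fin m) → toℕ i ≤ᵇ toℕ (iter (toℕ k) f i)) (λ k → toℕ i ≤ᵇ toℕ (iter (toℕ k) g i))
    (λ k → cong (λ y → toℕ i ≤ᵇ toℕ y) (iter-cong f≗g (toℕ k) i))

invariantᵇ : ∀ {m} → (Fin m → Fin m) → Subset m → Bool
invariantᵇ τ ℓ = allF (λ p → does (lookup ℓ (τ p) Bool.≟ lookup ℓ p))

invariantᵇ⁺ : ∀ {m} (τ : Fin m → Fin m) ℓ → (∀ p → lookup ℓ (τ p) ≡ lookup ℓ p) → invariantᵇ τ ℓ ≡ true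
invariantᵇ⁺ τ ℓ h = allF-true⁺ _ (λ p → dec-true (lookup ℓ (τ p) Bool.≟ lookup ℓ p) (h p))

invariantᵇ⁻ : ∀ {m} (τ : Fin m → Fin m) ℓ → invariantᵇ τ ℓ ≡ true → ∀ p → lookup ℓ (τ p) ≡ lookup ℓ p
invariantᵇ⁻ τ ℓ h p with lookup ℓ (τ p) Bool.≟ lookup ℓ p | allF-true⁻ _ h p
... | yes eq | _ = eq

invariantᵇ-∁ : ∀ {m} (τ : Fin m → Fin m) ℓ → invariantᵇ τ ℓ ≡ true → invariantᵇ τ (∁ ℓ) ≡ true
invariantᵇ-∁ τ ℓ h = invariantᵇ⁺ τ (∁ ℓ) λ p →
  trans (lookup-∁ ℓ (τ p)) (trans (cong not (invariantᵇ⁻ τ ℓ h p)) (sym (lookup-∁ ℓ p)))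

module PermutationOrbits {m} (τ : Fin m → Fin m) (τ-injective : Injective _≡_ _≡_ τ) where

  τ^ : ℕ → Fin m → Fin m
  τ^ k = iter k τ

  τ^-injective : ∀ k {x y} → τ^ k x ≡ τ^ k y → x ≡ y
  τ^-injective zero    eq = eq
  τ^-injective (suc k) eq = τ^-injective k (τ-injective eq)

  period : ∀ x → ∃ λ p → 0 < p × p ≤ m × τ^ p x ≡ x
  period x with pigeonhole (n<1+n m) (λ (k : Fin (suc m)) → τ^ (toℕ k) x)
  ... | i , j , i<j , τⁱx≡τʲx = toℕ j ∸ toℕ i , m<n⇒0<n∸m i<j , p≤m , τ^-injective (toℕ i) τⁱ⁺ᵖx≡τⁱx
    where
    p≤m = ≤-trans (m∸n≤m (toℕ j) (toℕ i)) (toℕ≤pred[n] j)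
    τⁱ⁺ᵖx≡τⁱx : τ^ (toℕ i) (τ^ (toℕ j ∸ toℕ i) x) ≡ τ^ (toℕ i) x
    τⁱ⁺ᵖx≡τⁱx = begin
      τ^ (toℕ i) (τ^ (toℕ j ∸ toℕ i) x)  ≡⟨ iter-+ τ (toℕ i) _ x ⟨
      τ^ (toℕ i + (toℕ j ∸ toℕ i)) x     ≡⟨ cong (λ k → τ^ k x) (m+[n∸m]≡n (<⇒≤ i<j)) ⟩
      τ^ (toℕ j) x                       ≡⟨ τⁱx≡τʲx ⟨
      τ^ (toℕ i) x                       ∎
      where open ≡-Reasoning

  τ^-reduce : ∀ k x → ∃ λ k′ → k′ < m × τ^ k x ≡ τ^ k′ x
  τ^-reduce k x with period x
  ... | p@(suc _) , _ , p≤m , τᵖx≡x = k % p , <-≤-trans (m%n<n k p) p≤m , (begin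
    τ^ k x                        ≡⟨ cong (λ k → τ^ k x) (m≡m%n+[m/n]*n k p) ⟩
    τ^ (k % p + k / p * p) x      ≡⟨ iter-+ τ (k % p) _ x ⟩
    τ^ (k % p) (τ^ (k / p * p) x) ≡⟨ cong (τ^ (k % p)) (iter-periodic τ p x τᵖx≡x (k / p)) ⟩
    τ^ (k % p) x                  ∎)
    where open ≡-Reasoning

  orbitList : Fin m → List (Fin m)
  orbitList x = List.tabulate (λ (k : Fin m) → τ^ (toℕ k) x)

  rep : Fin m → Fin m
  rep x = argmin toℕ x (orbitList x)

  rep-∈-orbit : ∀ x → ∃ λ j → rep x ≡ τ^ j x
  rep-∈-orbit x = argmin-all toℕ (0 , refl) (All.tabulate λ k∈ → ∃-in-orbit (∈-tabulate⁻ k∈))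
    where
    ∃-in-orbit : ∀ {y} → ∃ (λ (k : Fin m) → y ≡ τ^ (toℕ k) x) → ∃ λ j → y ≡ τ^ j x
    ∃-in-orbit (k , y≡) = toℕ k , y≡

  rep-minimal : ∀ x k → toℕ (rep x) ≤ toℕ (τ^ k x)
  rep-minimal x k with τ^-reduce k x
  ... | k′ , k′<m , τᵏx≡τᵏ′x = subst (λ y → toℕ (rep x) ≤ toℕ y) (sym τᵏx≡τᵏ′x) rep≤τᵏ′x
    where
    rep≤τᵏ′x : toℕ (rep x) ≤ toℕ (τ^ k′ x)
    rep≤τᵏ′x = subst (λ j → toℕ (rep x) ≤ toℕ (τ^ j x)) (toℕ-fromℕ< k′<m)
      (All.lookup (f[argmin]≤f[xs] {f = toℕ} x (orbitList x)) (∈-tabulate⁺ (fromℕ< k′<m)))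

  τ^-suc : ∀ k x → τ^ (suc k) x ≡ τ^ k (τ x)
  τ^-suc k x = trans (cong (λ j → τ^ j x) (+-comm 1 k)) (iter-+ τ k 1 x)

  rep∘τ : ∀ x → rep (τ x) ≡ rep x
  rep∘τ x with rep-∈-orbit x | rep-∈-orbit (τ x) | period x
  ... | i , rep[x]≡τⁱx | j , rep[τx]≡τʲτx | suc p , _ , _ , τᵖ⁺¹x≡x =
    toℕ-injective (≤-antisym rep[τx]≤rep[x] rep[x]≤rep[τx])
    where
    x≡τᵖτx : x ≡ τ^ p (τ x)
    x≡τᵖτx = trans (sym τᵖ⁺¹x≡x) (τ^-suc p x)
    rep[τx]≤rep[x] : toℕ (rep (τ x)) ≤ toℕ (rep x)
    rep[τx]≤rep[x] = subst (λ y → toℕ (rep (τ x)) ≤ toℕ y)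
      (sym (trans rep[x]≡τⁱx (trans (cong (τ^ i) x≡τᵖτx) (sym (iter-+ τ i p (τ x))))))
      (rep-minimal (τ x) (i + p))
    rep[x]≤rep[τx] : toℕ (rep x) ≤ toℕ (rep (τ x))
    rep[x]≤rep[τx] = subst (λ y → toℕ (rep x) ≤ toℕ y)
      (sym (trans rep[τx]≡τʲτx (sym (τ^-suc j x))))
      (rep-minimal x (suc j))

  orbitRep-rep : ∀ x → orbitRep τ (rep x) ≡ true
  orbitRep-rep x with rep-∈-orbit x
  ... | j , rep[x]≡τʲx = allF-true⁺ (λ (k : Fin m) → toℕ (rep x) ≤ᵇ toℕ (τ^ (toℕ k) (rep x))) λ k →
        T⇒≡true (≤⇒≤ᵇ (subst (λ y → toℕ (rep x) ≤ toℕ y)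
          (sym (trans (cong (τ^ (toℕ k)) rep[x]≡τʲx) (sym (iter-+ τ (toℕ k) j x))))
          (rep-minimal x (toℕ k + j))))

  orbitRep⇒rep≡ : ∀ x → orbitRep τ x ≡ true → rep x ≡ x
  orbitRep⇒rep≡ x h with rep-∈-orbit x
  ... | j , rep[x]≡τʲx with τ^-reduce j x
  ...   | j′ , j′<m , τʲx≡τʲ′x = toℕ-injective (≤-antisym (f[argmin]≤f[⊤] {f = toℕ} x (orbitList x)) x≤rep[x])
    where
    x≤τʲ′x : toℕ x ≤ toℕ (τ^ j′ x)
    x≤τʲ′x = subst (λ k → toℕ x ≤ toℕ (τ^ k x)) (toℕ-fromℕ< j′<m)
      (≤ᵇ⇒≤ _ _ (≡true⇒T (allF-true⁻ (λ (k : Fin m) → toℕ x ≤ᵇ toℕ (τ^ (toℕ k) x)) h (fromℕ< j′<m))))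
    x≤rep[x] : toℕ x ≤ toℕ (rep x)
    x≤rep[x] = subst (λ y → toℕ x ≤ toℕ y) (sym (trans rep[x]≡τʲx τʲx≡τʲ′x)) x≤τʲ′x

  invariant-τ^ : ∀ (ℓ : Subset m) → (∀ p → lookup ℓ (τ p) ≡ lookup ℓ p) → ∀ k p → lookup ℓ (τ^ k p) ≡ lookup ℓ p
  invariant-τ^ ℓ h zero    p = refl
  invariant-τ^ ℓ h (suc k) p = trans (h (τ^ k p)) (invariant-τ^ ℓ h k p)

  representatives : Subset m
  representatives = tabulate (orbitRep τ)

  restrict : Subset m → Subset m
  restrict ℓ = tabulate (λ p → lookup ℓ p ∧ orbitRep τ p)

  extend : Subset m → Subset m
  extend S = tabulate (lookup S ∘ rep)

  restrict-⊆ : ∀ ℓ → restrict ℓ ⊆ˢ representatives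
  restrict-⊆ ℓ p ℓp∧repᵖ = trans (lookup∘tabulate (orbitRep τ) p)
    (proj₂ (∧-true⁻ {lookup ℓ p} (trans (sym (lookup∘tabulate (λ p → lookup ℓ p ∧ orbitRep τ p) p)) ℓp∧repᵖ)))

  extend-invariant : ∀ S → invariantᵇ τ (extend S) ≡ true
  extend-invariant S = invariantᵇ⁺ τ (extend S) λ p → begin
    lookup (extend S) (τ p)  ≡⟨ lookup∘tabulate (lookup S ∘ rep) (τ p) ⟩
    lookup S (rep (τ p))     ≡⟨ cong (lookup S) (rep∘τ p) ⟩
    lookup S (rep p)         ≡⟨ lookup∘tabulate (lookup S ∘ rep) p ⟨
    lookup (extend S) p      ∎
    where open ≡-Reasoning

  extend∘restrict : ∀ ℓ → invariantᵇ τ ℓ ≡ true → extend (restrict ℓ) ≡ ℓ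
  extend∘restrict ℓ inv = tabulate-≡ λ p → begin
    lookup (restrict ℓ) (rep p)            ≡⟨ lookup∘tabulate (λ p → lookup ℓ p ∧ orbitRep τ p) (rep p) ⟩
    lookup ℓ (rep p) ∧ orbitRep τ (rep p)  ≡⟨ cong (lookup ℓ (rep p) ∧_) (orbitRep-rep p) ⟩
    lookup ℓ (rep p) ∧ true                ≡⟨ ∧-identityʳ _ ⟩
    lookup ℓ (rep p)                       ≡⟨ constant-on-orbit p (rep-∈-orbit p) ⟩
    lookup ℓ p                             ∎
    where
    open ≡-Reasoning
    constant-on-orbit : ∀ p → (∃ λ j → rep p ≡ τ^ j p) → lookup ℓ (rep p) ≡ lookup ℓ p
    constant-on-orbit p (j , rep[p]≡τʲp) = trans (cong (lookup ℓ) rep[p]≡τʲp) (invariant-τ^ ℓ (invariantᵇ⁻ τ ℓ inv) j p)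

  restrict∘extend : ∀ S → S ⊆ˢ representatives → restrict (extend S) ≡ S
  restrict∘extend S S⊆R = tabulate-≡ λ p →
    trans (cong (_∧ orbitRep τ p) (lookup∘tabulate (lookup S ∘ rep) p)) (keep-representative p)
    where
    keep-representative : ∀ p → (lookup S (rep p) ∧ orbitRep τ p) ≡ lookup S p
    keep-representative p with orbitRep τ p in repᵖ
    ... | true  = trans (∧-identityʳ _) (cong (lookup S) (orbitRep⇒rep≡ p repᵖ))
    ... | false = trans (∧-zeroʳ _) (sym (⊆ˢ-∉ S representatives S⊆R p (trans (lookup∘tabulate (orbitRep τ) p) repᵖ)))

  invariant≅⊆representatives : invariantᵇ τ ≅ˢ (_⊆ᵇ representatives)
  invariant≅⊆representatives = record
    { to      = restrict
    ; from    = extend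
    ; to-∈    = λ {ℓ} _ → ⊆ᵇ⁺ (restrict ℓ) representatives (restrict-⊆ ℓ)
    ; from-∈  = λ {S} _ → extend-invariant S
    ; from∘to = λ {ℓ} → extend∘restrict ℓ
    ; to∘from = λ {S} S⊆R → restrict∘extend S (⊆ᵇ⁻ S representatives S⊆R)
    }

  #invariant≡2^orbits : #ˢ (invariantᵇ τ) ≡ 2 ^ orbits τ
  #invariant≡2^orbits = begin
    #ˢ (invariantᵇ τ)         ≡⟨ #ˢ-cong-≅ invariant≅⊆representatives ⟩
    #ˢ (_⊆ᵇ representatives)  ≡⟨ #ˢ-⊆ representatives ⟩
    2 ^ card representatives  ≡⟨ cong (2 ^_) card[R]≡orbits ⟩
    2 ^ orbits τ              ∎
    where
    open ≡-Reasoning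
    card[R]≡orbits : card representatives ≡ orbits τ
    card[R]≡orbits = trans (countF≡∑ (lookup representatives))
      (trans (ℕ-Sum.sum-cong-≗ (λ p → cong 𝟙 (lookup∘tabulate (orbitRep τ) p))) (sym (countF≡∑ (orbitRep τ))))

-- Rank and kernel over ℤ₂

foldr-∧-true⁺ : ∀ {A : Set} (P : A → Bool) (xs : List A) → (∀ x → P x ≡ true) →
  List.foldr (λ x b → P x ∧ b) true xs ≡ true
foldr-∧-true⁺ P []       h = refl
foldr-∧-true⁺ P (y ∷ xs) h rewrite h y = foldr-∧-true⁺ P xs h

foldr-∧-true⁻ : ∀ {A : Set} (P : A → Bool) {xs : List A} {x} →
  List.foldr (λ y b → P y ∧ b) true xs ≡ true → x ∈ xs → P x ≡ true
foldr-∧-true⁻ P {y ∷ xs} h x∈ with P y in Py | x∈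
... | true | here refl   = Py
... | true | there x∈xs = foldr-∧-true⁻ P h x∈xs

foldr-∧-false⁻ : ∀ {A : Set} (P : A → Bool) (xs : List A) →
  List.foldr (λ y b → P y ∧ b) true xs ≡ false → ∃ λ x → P x ≡ false
foldr-∧-false⁻ P (y ∷ xs) h with P y in Py
... | false = y , Py
... | true  = foldr-∧-false⁻ P xs h

∈-allSubsets : ∀ {k} (S : Subset k) → S ∈ allSubsets k
∈-allSubsets []          = here refl
∈-allSubsets (true ∷ S)  = ∈-++⁺ˡ (∈-map⁺ (true ∷_) (∈-allSubsets S))
∈-allSubsets {suc k} (false ∷ S) = ∈-++⁺ʳ (map (true ∷_) (allSubsets k)) (∈-map⁺ (false ∷_) (∈-allSubsets S))

≤-maximumL : ∀ {x xs} → x ∈ xs → x ≤ maximumL xs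
≤-maximumL {xs = y ∷ xs} (here refl) = m≤m⊔n y (maximumL xs)
≤-maximumL {xs = y ∷ xs} (there x∈) = m≤n⇒m≤o⊔n y (≤-maximumL x∈)

maximumL-∈ : ∀ {x xs} → x ∈ xs → maximumL xs ∈ xs
maximumL-∈ {xs = y ∷ xs} _ = go y xs
  where
  go : ∀ y xs → maximumL (y ∷ xs) ∈ y ∷ xs
  go y []       = here (⊔-identityʳ y)
  go y (z ∷ xs) with ⊔-sel y (maximumL (z ∷ xs))
  ... | inj₁ y⊔≡y = here y⊔≡y
  ... | inj₂ y⊔≡m = there (subst (_∈ z ∷ xs) (sym y⊔≡m) (go z xs))

module _ {n} (M : Fin n → Fin n → Bool) where

  rowSum-cong : ∀ (S R : Subset n) → (∀ k → lookup S k ≡ lookup R k) → ∀ j → rowSum M S j ≡ rowSum M R j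
  rowSum-cong S R h j = cong (λ X → rowSum M X j) (lookup-ext {xs = S} {ys = R} h)

  rowSum-△ : ∀ S R j → rowSum M (S △ R) j ≡ rowSum M S j xor rowSum M R j
  rowSum-△ S R j = begin
    rowSum M (S △ R) j                                          ≡⟨ rowSum≡⨁ M (S △ R) j ⟩
    ⨁ (λ k → lookup (S △ R) k ∧ M k j)                          ≡⟨ 𝔽₂-Sum.sum-cong-≗ distribute ⟩
    ⨁ (λ k → (lookup S k ∧ M k j) xor (lookup R k ∧ M k j))     ≡⟨ 𝔽₂-Sum.∑-distrib-+ (λ k → lookup S k ∧ M k j) _ ⟩
    ⨁ (λ k → lookup S k ∧ M k j) xor ⨁ (λ k → lookup R k ∧ M k j) ≡⟨ cong₂ _xor_ (rowSum≡⨁ M S j) (rowSum≡⨁ M R j) ⟨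
    rowSum M S j xor rowSum M R j                               ∎
    where
    open ≡-Reasoning
    distribute : ∀ k → (lookup (S △ R) k ∧ M k j) ≡ ((lookup S k ∧ M k j) xor (lookup R k ∧ M k j))
    distribute k = trans (cong (_∧ M k j) (lookup∘tabulate _ k)) (∧-distribʳ-xor (M k j) (lookup S k) (lookup R k))

  rowSum-⁅⁆ : ∀ i j → rowSum M ⁅ i ⁆ j ≡ M i j
  rowSum-⁅⁆ i j = trans (rowSum≡⨁ M ⁅ i ⁆ j)
    (trans (𝔽₂-Sum.sum-cong-≗ (λ k → cong (_∧ M k j) (lookup∘tabulate _ k))) (⨁-select i (λ k → M k j)))

  combination : Subset n → (Fin n → Subset n) → Subset n
  combination U W = tabulate (λ k → ⨁ (λ i → lookup U i ∧ lookup (W i) k))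

  rowSum-combination : ∀ U W j → rowSum M (combination U W) j ≡ ⨁ (λ i → lookup U i ∧ rowSum M (W i) j)
  rowSum-combination U W j = begin
    rowSum M (combination U W) j
      ≡⟨ rowSum≡⨁ M (combination U W) j ⟩
    ⨁ (λ k → lookup (combination U W) k ∧ M k j)
      ≡⟨ 𝔽₂-Sum.sum-cong-≗ (λ k → trans (cong (_∧ M k j) (lookup∘tabulate _ k))
                                         (𝔽₂-Sum.*-distribʳ-sum (M k j) (λ i → lookup U i ∧ lookup (W i) k))) ⟩
    ⨁ (λ k → ⨁ (λ i → (lookup U i ∧ lookup (W i) k) ∧ M k j))
      ≡⟨ 𝔽₂-Sum.∑-comm (λ k i → (lookup U i ∧ lookup (W i) k) ∧ M k j) ⟩
    ⨁ (λ i → ⨁ (λ k → (lookup U i ∧ lookup (W i) k) ∧ M k j))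
      ≡⟨ 𝔽₂-Sum.sum-cong-≗ (λ i → trans (𝔽₂-Sum.sum-cong-≗ (λ k → ∧-assoc (lookup U i) (lookup (W i) k) (M k j)))
                                         (sym (𝔽₂-Sum.*-distribˡ-sum (lookup U i) (λ k → lookup (W i) k ∧ M k j)))) ⟩
    ⨁ (λ i → lookup U i ∧ ⨁ (λ k → lookup (W i) k ∧ M k j))
      ≡⟨ 𝔽₂-Sum.sum-cong-≗ (λ i → cong (lookup U i ∧_) (sym (rowSum≡⨁ M (W i) j))) ⟩
    ⨁ (λ i → lookup U i ∧ rowSum M (W i) j) ∎
    where open ≡-Reasoning

module Z₂Rank {n} (M : Fin n → Fin n → Bool) (A : Subset n) where

  Vanishes : Subset n → Set
  Vanishes T = ∀ j → lookup A j ≡ true → rowSum M T j ≡ false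

  kernelᵇ : Subset n → Bool
  kernelᵇ T = (T ⊆ᵇ A) ∧ allF (λ j → not (lookup A j ∧ rowSum M T j))

  kernelᵇ⁺ : ∀ T → T ⊆ˢ A → Vanishes T → kernelᵇ T ≡ true
  kernelᵇ⁺ T T⊆A T-vanishes = cong₂ _∧_ (⊆ᵇ⁺ T A T⊆A) (allF-true⁺ (λ j → not (lookup A j ∧ rowSum M T j)) outside-A)
    where
    outside-A : ∀ j → not (lookup A j ∧ rowSum M T j) ≡ true
    outside-A j with lookup A j in Aⱼ
    ... | false = refl
    ... | true  rewrite T-vanishes j Aⱼ = refl

  kernelᵇ⁻ : ∀ T → kernelᵇ T ≡ true → T ⊆ˢ A × Vanishes T
  kernelᵇ⁻ T h = ⊆ᵇ⁻ T A (proj₁ (∧-true⁻ h)) , vanishes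
    where
    vanishes : Vanishes T
    vanishes j Aⱼ with allF-true⁻ (λ j → not (lookup A j ∧ rowSum M T j)) (proj₂ (∧-true⁻ {T ⊆ᵇ A} h)) j
    ... | not[A∧row] rewrite Aⱼ with rowSum M T j
    ...   | false = refl

  independence-clause : Subset n → Subset n → Bool
  independence-clause S T = not ((T ⊆ᵇ S) ∧ nonEmptyᵇ T) ∨ anyF (λ j → lookup A j ∧ rowSum M T j)

  no-witness : ∀ T → Vanishes T → anyF (λ j → lookup A j ∧ rowSum M T j) ≡ false
  no-witness T T-vanishes = anyF-false⁺ _ witness
    where
    witness : ∀ j → (lookup A j ∧ rowSum M T j) ≡ false
    witness j with lookup A j in Aⱼ
    ... | false = refl
    ... | true  = T-vanishes j Aⱼ

  private
    clause-true⁻ : ∀ a b c → (not (a ∧ b) ∨ c) ≡ true → a ≡ true → c ≡ false → b ≡ false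
    clause-true⁻ true false false _ _ _ = refl

    clause-false⁻ : ∀ a b c → (not (a ∧ b) ∨ c) ≡ false → a ≡ true × b ≡ true × c ≡ false
    clause-false⁻ true true false _ = refl , refl , refl

  independent⁻ : ∀ {S} → independentIn M A S ≡ true →
    ∀ T → T ⊆ˢ S → Vanishes T → ∀ i → lookup T i ≡ false
  independent⁻ {S} S-independent T T⊆S T-vanishes =
    anyF-false⁻ (lookup T) (clause-true⁻ (T ⊆ᵇ S) (nonEmptyᵇ T) _ clause (⊆ᵇ⁺ T S T⊆S) (no-witness T T-vanishes))
    where
    clause : independence-clause S T ≡ true
    clause = foldr-∧-true⁻ (independence-clause S) S-independent (∈-allSubsets T)

  dependent⁻ : ∀ {S} → independentIn M A S ≡ false →
    ∃ λ T → T ⊆ˢ S × Vanishes T × ∃ λ i → lookup T i ≡ true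
  dependent⁻ {S} S-dependent with foldr-∧-false⁻ (independence-clause S) (allSubsets n) S-dependent
  ... | T , clause with clause-false⁻ (T ⊆ᵇ S) (nonEmptyᵇ T) _ clause
  ...   | T⊆S , T≢∅ , no-witness′ = T , ⊆ᵇ⁻ T S T⊆S , vanishes , anyF-true⁻ (lookup T) T≢∅
    where
    vanishes : Vanishes T
    vanishes j Aⱼ with anyF-false⁻ (λ j → lookup A j ∧ rowSum M T j) no-witness′ j
    ... | A∧row rewrite Aⱼ = A∧row

  ∅-independent : independentIn M A ∅ ≡ true
  ∅-independent = foldr-∧-true⁺ (independence-clause ∅) (allSubsets n) clause
    where
    clause : ∀ T → independence-clause ∅ T ≡ true
    clause T with T ⊆ᵇ ∅ in T⊆∅
    ... | false = refl
    ... | true  rewrite anyF-false⁺ (lookup T) (λ i → ⊆ˢ-∉ T ∅ (⊆ᵇ⁻ T ∅ T⊆∅) i (lookup-replicate i false)) = refl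

  candidates : List (Subset n)
  candidates = filter (λ S → (S ⊆ᵇ A ∧ independentIn M A S) Bool.≟ true) (allSubsets n)

  candidate⁺ : ∀ S → S ⊆ˢ A → independentIn M A S ≡ true → S ∈ candidates
  candidate⁺ S S⊆A S-independent =
    ∈-filter⁺ (λ S → (S ⊆ᵇ A ∧ independentIn M A S) Bool.≟ true) (∈-allSubsets S) (cong₂ _∧_ (⊆ᵇ⁺ S A S⊆A) S-independent)

  card≤rank : ∀ S → S ⊆ˢ A → independentIn M A S ≡ true → card S ≤ rankOn M A
  card≤rank S S⊆A S-independent = ≤-maximumL (∈-map⁺ card (candidate⁺ S S⊆A S-independent))

  maximum-independent : ∃ λ B → B ⊆ˢ A × independentIn M A B ≡ true × card B ≡ rankOn M A
  maximum-independent with ∈-map⁻ card (maximumL-∈ (∈-map⁺ card (candidate⁺ ∅ (∅-⊆ A) ∅-independent)))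
  ... | B , B∈ , rank≡card
      with ∧-true⁻ (proj₂ (∈-filter⁻ (λ S → (S ⊆ᵇ A ∧ independentIn M A S) Bool.≟ true) {xs = allSubsets n} B∈))
  ...   | B⊆A , B-independent = B , ⊆ᵇ⁻ B A B⊆A , B-independent , sym rank≡card

  module MaximumIndependent (B : Subset n) (B⊆A : B ⊆ˢ A) (B-independent : independentIn M A B ≡ true)
    (B-maximum : ∀ S → S ⊆ˢ A → independentIn M A S ≡ true → card S ≤ card B) where

    Spans : Fin n → Subset n → Set
    Spans i W = W ⊆ˢ B × (∀ j → lookup A j ≡ true → rowSum M W j ≡ M i j)

    insert-⊆ : ∀ i → lookup A i ≡ true → insert B i ⊆ˢ A
    insert-⊆ i Aᵢ k k∈ with lookup B k in Bₖ | eqF k i in k≡i | trans (sym (lookup∘tabulate _ k)) k∈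
    ... | true  | _    | _ = B⊆A k Bₖ
    ... | false | true | _ = subst (λ k → lookup A k ≡ true) (sym (eqF-true⁻ k≡i)) Aᵢ

    insert-dependent : ∀ i → lookup A i ≡ true → lookup B i ≡ false → independentIn M A (insert B i) ≡ false
    insert-dependent i Aᵢ Bᵢ with independentIn M A (insert B i) in B∪i-independent
    ... | false = refl
    ... | true  = contradiction (B-maximum (insert B i) (insert-⊆ i Aᵢ) B∪i-independent)
                    (<⇒≱ (subst (card B <_) (sym (card-insert B i Bᵢ)) (n<1+n (card B))))

    remove-new : ∀ i T → T ⊆ˢ insert B i → T ∖ ⁅ i ⁆ ⊆ˢ B
    remove-new i T T⊆B∪i l l∈ with lookup T l in Tₗ | eqF l i in l≢i | trans (sym (lookup-∖⁅⁆ T i l)) l∈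
    ... | true | false | _ = trans (sym (lookup-insert-≢ B l≢i)) (T⊆B∪i l Tₗ)
    ... | true | true  | ()

    new-in-dependency : ∀ i T → T ⊆ˢ insert B i → Vanishes T → ∀ k → lookup T k ≡ true → lookup T i ≡ true
    new-in-dependency i T T⊆B∪i T-vanishes k Tₖ with lookup T i in Tᵢ
    ... | true  = refl
    ... | false = contradiction (independent⁻ {B} B-independent T T⊆B T-vanishes k)
                    (λ Tₖ≡false → true≢false (trans (sym Tₖ) Tₖ≡false))
      where
      T⊆B : T ⊆ˢ B
      T⊆B l Tₗ with eqF l i in l≡i
      ... | false = trans (sym (lookup-insert-≢ B l≡i)) (T⊆B∪i l Tₗ)
      ... | true  = contradiction (trans (sym Tₗ) (trans (cong (lookup T) (eqF-true⁻ l≡i)) Tᵢ)) true≢false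

    row-spanned : ∀ i → lookup A i ≡ true → ∃ (Spans i)
    row-spanned i Aᵢ with lookup B i in Bᵢ
    ... | true  = ⁅ i ⁆ , ⁅i⁆⊆B , (λ j _ → rowSum-⁅⁆ M i j)
      where
      ⁅i⁆⊆B : ⁅ i ⁆ ⊆ˢ B
      ⁅i⁆⊆B k k∈⁅i⁆ = subst (λ k → lookup B k ≡ true) (sym (eqF-true⁻ (trans (sym (lookup∘tabulate _ k)) k∈⁅i⁆))) Bᵢ
    ... | false with dependent⁻ {insert B i} (insert-dependent i Aᵢ Bᵢ)
    ...   | T , T⊆B∪i , T-vanishes , k , Tₖ = T ∖ ⁅ i ⁆ , remove-new i T T⊆B∪i , spans
      where
      Tᵢ : lookup T i ≡ true
      Tᵢ = new-in-dependency i T T⊆B∪i T-vanishes k Tₖ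
      T≡W△⁅i⁆ : ∀ l → lookup T l ≡ lookup (T ∖ ⁅ i ⁆ △ ⁅ i ⁆) l
      T≡W△⁅i⁆ l rewrite lookup∘tabulate (λ l → lookup (T ∖ ⁅ i ⁆) l xor lookup ⁅ i ⁆ l) l
                      | lookup-∖⁅⁆ T i l | lookup∘tabulate (λ k → eqF k i) l with eqF l i in l≡i
      ... | false = sym (trans (xor-identityʳ _) (∧-identityʳ _))
      ... | true  = trans (cong (lookup T) (eqF-true⁻ l≡i)) (trans Tᵢ (cong (_xor true) (sym (∧-zeroʳ (lookup T l)))))
      spans : ∀ j → lookup A j ≡ true → rowSum M (T ∖ ⁅ i ⁆) j ≡ M i j
      spans j Aⱼ = xor-cancel (begin
        rowSum M (T ∖ ⁅ i ⁆) j xor M i j             ≡⟨ cong (rowSum M (T ∖ ⁅ i ⁆) j xor_) (rowSum-⁅⁆ M i j) ⟨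
        rowSum M (T ∖ ⁅ i ⁆) j xor rowSum M ⁅ i ⁆ j  ≡⟨ rowSum-△ M (T ∖ ⁅ i ⁆) ⁅ i ⁆ j ⟨
        rowSum M (T ∖ ⁅ i ⁆ △ ⁅ i ⁆) j              ≡⟨ rowSum-cong M T (T ∖ ⁅ i ⁆ △ ⁅ i ⁆) T≡W△⁅i⁆ j ⟨
        rowSum M T j                                ≡⟨ T-vanishes j Aⱼ ⟩
        false                                       ∎)
        where open ≡-Reasoning

    span-of : ∀ i b → lookup A i ≡ b → Subset n
    span-of i true  Aᵢ = proj₁ (row-spanned i Aᵢ)
    span-of i false _  = ∅

    span-of-spans : ∀ i b (Aᵢ≡b : lookup A i ≡ b) → lookup A i ≡ true → Spans i (span-of i b Aᵢ≡b)
    span-of-spans i true  Aᵢ _  = proj₂ (row-spanned i Aᵢ)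
    span-of-spans i false Aᵢ Aᵢ′ = contradiction (trans (sym Aᵢ′) Aᵢ) true≢false

    span-of-⊆ : ∀ i b (Aᵢ≡b : lookup A i ≡ b) → span-of i b Aᵢ≡b ⊆ˢ B
    span-of-⊆ i true  Aᵢ = proj₁ (proj₂ (row-spanned i Aᵢ))
    span-of-⊆ i false _  = ∅-⊆ B

    span : Fin n → Subset n
    span i = span-of i (lookup A i) refl

    span-spans : ∀ i → lookup A i ≡ true → Spans i (span i)
    span-spans i = span-of-spans i (lookup A i) refl

    span-⊆ : ∀ i → span i ⊆ˢ B
    span-⊆ i = span-of-⊆ i (lookup A i) refl

    combination-⊆ : ∀ U → combination M U span ⊆ˢ B
    combination-⊆ U k k∈ with lookup B k in Bₖ
    ... | true  = refl
    ... | false = contradiction (trans (sym (trans (lookup∘tabulate _ k) (⨁-zero outside))) k∈) λ ()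
      where
      outside : ∀ i → (lookup U i ∧ lookup (span i) k) ≡ false
      outside i = trans (cong (lookup U i ∧_) (⊆ˢ-∉ (span i) B (span-⊆ i) k Bₖ)) (∧-zeroʳ (lookup U i))

    rowSum-combination-span : ∀ U → U ⊆ˢ A → ∀ j → lookup A j ≡ true → rowSum M (combination M U span) j ≡ rowSum M U j
    rowSum-combination-span U U⊆A j Aⱼ = begin
      rowSum M (combination M U span) j           ≡⟨ rowSum-combination M U span j ⟩
      ⨁ (λ i → lookup U i ∧ rowSum M (span i) j)  ≡⟨ 𝔽₂-Sum.sum-cong-≗ row ⟩
      ⨁ (λ i → lookup U i ∧ M i j)                ≡⟨ rowSum≡⨁ M U j ⟨
      rowSum M U j                                ∎
      where
      open ≡-Reasoning
      row : ∀ i → (lookup U i ∧ rowSum M (span i) j) ≡ (lookup U i ∧ M i j)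
      row i with lookup U i in Uᵢ
      ... | false = refl
      ... | true  = proj₂ (span-spans i (U⊆A i Uᵢ)) j Aⱼ

    rows-independent : ∀ X Y → X ⊆ˢ B → Y ⊆ˢ B →
      (∀ j → lookup A j ≡ true → rowSum M X j ≡ rowSum M Y j) → X ≡ Y
    rows-independent X Y X⊆B Y⊆B same-rows = lookup-ext λ k →
      xor-cancel (trans (sym (lookup∘tabulate _ k)) (independent⁻ {B} B-independent (X △ Y) X△Y⊆B vanishes k))
      where
      X△Y⊆B : X △ Y ⊆ˢ B
      X△Y⊆B k k∈ with lookup X k in Xₖ | trans (sym (lookup∘tabulate _ k)) k∈
      ... | true  | _  = X⊆B k Xₖ
      ... | false | Yₖ = Y⊆B k Yₖ
      vanishes : Vanishes (X △ Y)
      vanishes j Aⱼ = trans (rowSum-△ M X Y j) (trans (cong (_xor rowSum M Y j) (same-rows j Aⱼ)) (xor-same (rowSum M Y j)))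

    complete : Subset n → Subset n
    complete U = U △ combination M U span

    ∖-mono : ∀ T → T ⊆ˢ A → T ∖ B ⊆ˢ A ∖ B
    ∖-mono T T⊆A k k∈ with lookup T k in Tₖ | trans (sym (lookup∘tabulate _ k)) k∈
    ... | true | notBₖ = trans (lookup∘tabulate _ k) (cong₂ _∧_ (T⊆A k Tₖ) notBₖ)

    ∖B-⊆ : ∀ U → U ⊆ˢ A ∖ B → U ⊆ˢ A
    ∖B-⊆ U U⊆A∖B k Uₖ = proj₁ (∧-true⁻ (trans (sym (lookup∘tabulate _ k)) (U⊆A∖B k Uₖ)))

    ∖B-disjoint : ∀ U → U ⊆ˢ A ∖ B → ∀ k → lookup B k ≡ true → lookup U k ≡ false
    ∖B-disjoint U U⊆A∖B k Bₖ = ⊆ˢ-∉ U (A ∖ B) U⊆A∖B k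
      (trans (lookup∘tabulate _ k) (trans (cong (λ b → lookup A k ∧ not b) Bₖ) (∧-zeroʳ (lookup A k))))

    complete-kernel : ∀ U → U ⊆ˢ A ∖ B → kernelᵇ (complete U) ≡ true
    complete-kernel U U⊆A∖B = kernelᵇ⁺ (complete U) ⊆A vanishes
      where
      ⊆A : complete U ⊆ˢ A
      ⊆A k k∈ with lookup U k in Uₖ | trans (sym (lookup∘tabulate _ k)) k∈
      ... | true  | _ = ∖B-⊆ U U⊆A∖B k Uₖ
      ... | false | combinationₖ = B⊆A k (combination-⊆ U k combinationₖ)
      vanishes : Vanishes (complete U)
      vanishes j Aⱼ = trans (rowSum-△ M U (combination M U span) j)
        (trans (cong (rowSum M U j xor_) (rowSum-combination-span U (∖B-⊆ U U⊆A∖B) j Aⱼ)) (xor-same (rowSum M U j)))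

    ∖B△∩B : ∀ T k → (lookup (T ∖ B) k xor lookup (T ∩ B) k) ≡ lookup T k
    ∖B△∩B T k rewrite lookup∘tabulate (λ i → lookup T i ∧ not (lookup B i)) k
                    | lookup∘tabulate (λ i → lookup T i ∧ lookup B i) k
                    with lookup T k | lookup B k
    ... | true  | true  = refl
    ... | true  | false = refl
    ... | false | _     = refl

    combination-∖B : ∀ T → T ⊆ˢ A → Vanishes T → combination M (T ∖ B) span ≡ T ∩ B
    combination-∖B T T⊆A T-vanishes = rows-independent _ (T ∩ B) (combination-⊆ (T ∖ B)) T∩B⊆B λ j Aⱼ → begin
      rowSum M (combination M (T ∖ B) span) j ≡⟨ rowSum-combination-span (T ∖ B) (∖B-⊆ (T ∖ B) (∖-mono T T⊆A)) j Aⱼ ⟩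
      rowSum M (T ∖ B) j                      ≡⟨ xor-cancel (begin
          rowSum M (T ∖ B) j xor rowSum M (T ∩ B) j ≡⟨ rowSum-△ M (T ∖ B) (T ∩ B) j ⟨
          rowSum M (T ∖ B △ T ∩ B) j
            ≡⟨ rowSum-cong M (T ∖ B △ T ∩ B) T (λ k → trans (lookup∘tabulate _ k) (∖B△∩B T k)) j ⟩
          rowSum M T j                            ≡⟨ T-vanishes j Aⱼ ⟩
          false                                   ∎) ⟩
      rowSum M (T ∩ B) j                      ∎
      where
      open ≡-Reasoning
      T∩B⊆B : T ∩ B ⊆ˢ B
      T∩B⊆B k k∈ = proj₂ (∧-true⁻ (trans (sym (lookup∘tabulate _ k)) k∈))

    complete∘∖B : ∀ T → T ⊆ˢ A → Vanishes T → complete (T ∖ B) ≡ T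
    complete∘∖B T T⊆A T-vanishes = lookup-ext λ k → begin
      lookup (complete (T ∖ B)) k                                ≡⟨ lookup∘tabulate _ k ⟩
      lookup (T ∖ B) k xor lookup (combination M (T ∖ B) span) k
        ≡⟨ cong (λ X → lookup (T ∖ B) k xor lookup X k) (combination-∖B T T⊆A T-vanishes) ⟩
      lookup (T ∖ B) k xor lookup (T ∩ B) k                      ≡⟨ ∖B△∩B T k ⟩
      lookup T k                                                 ∎
      where open ≡-Reasoning

    ∖B∘complete : ∀ U → U ⊆ˢ A ∖ B → complete U ∖ B ≡ U
    ∖B∘complete U U⊆A∖B = lookup-ext λ k → trans (lookup∘tabulate _ k)
      (trans (cong (_∧ not (lookup B k)) (lookup∘tabulate _ k)) (keep k))
      where
      keep : ∀ k → ((lookup U k xor lookup (combination M U span) k) ∧ not (lookup B k)) ≡ lookup U k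
      keep k with lookup B k in Bₖ
      ... | true  = trans (∧-zeroʳ _) (sym (∖B-disjoint U U⊆A∖B k Bₖ))
      ... | false rewrite ⊆ˢ-∉ (combination M U span) B (combination-⊆ U) k Bₖ =
        trans (∧-identityʳ _) (xor-identityʳ (lookup U k))

    -- A kernel vector is determined by its part outside B, because every row of A is a
    -- combination of the rows of B and these are independent.
    kernel≅⊆A∖B : kernelᵇ ≅ˢ (_⊆ᵇ (A ∖ B))
    kernel≅⊆A∖B = record
      { to      = _∖ B
      ; from    = complete
      ; to-∈    = λ {T} T∈ker → ⊆ᵇ⁺ (T ∖ B) (A ∖ B) (∖-mono T (proj₁ (kernelᵇ⁻ T T∈ker)))
      ; from-∈  = λ {U} U⊆A∖B → complete-kernel U (⊆ᵇ⁻ U (A ∖ B) U⊆A∖B)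
      ; from∘to = λ {T} T∈ker → complete∘∖B T (proj₁ (kernelᵇ⁻ T T∈ker)) (proj₂ (kernelᵇ⁻ T T∈ker))
      ; to∘from = λ {U} U⊆A∖B → ∖B∘complete U (⊆ᵇ⁻ U (A ∖ B) U⊆A∖B)
      }

    #kernel : #ˢ kernelᵇ ≡ 2 ^ card (A ∖ B)
    #kernel = trans (#ˢ-cong-≅ kernel≅⊆A∖B) (#ˢ-⊆ (A ∖ B))

  #kernel*2^rank : #ˢ kernelᵇ * 2 ^ rankOn M A ≡ 2 ^ card A
  #kernel*2^rank with maximum-independent
  ... | B , B⊆A , B-independent , card[B]≡rank = begin
    #ˢ kernelᵇ * 2 ^ rankOn M A       ≡⟨ cong₂ (λ x r → x * 2 ^ r) #kernel (sym card[B]≡rank) ⟩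
    2 ^ card (A ∖ B) * 2 ^ card B     ≡⟨ ^-distribˡ-+-* 2 (card (A ∖ B)) (card B) ⟨
    2 ^ (card (A ∖ B) + card B)       ≡⟨ cong (2 ^_) (card-∖+card A B B⊆A) ⟩
    2 ^ card A                        ∎
    where
    open ≡-Reasoning
    open MaximumIndependent B B⊆A B-independent
      (λ S S⊆A S-independent → subst (card S ≤_) (sym card[B]≡rank) (card≤rank S S⊆A S-independent))

-- Chord diagrams

<ᵇ-true⁺ : ∀ {a b} → a < b → (a <ᵇ b) ≡ true
<ᵇ-true⁺ a<b = T⇒≡true (<⇒<ᵇ a<b)

<ᵇ-false⁺ : ∀ {a b} → b ≤ a → (a <ᵇ b) ≡ false
<ᵇ-false⁺ {a} {b} b≤a with a <ᵇ b in a<ᵇb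
... | false = refl
... | true  = contradiction b≤a (<⇒≱ (<ᵇ⇒< a b (≡true⇒T a<ᵇb)))

<ᵇ-irrefl : ∀ a → (a <ᵇ a) ≡ false
<ᵇ-irrefl a = <ᵇ-false⁺ (≤-refl {a})

<ᵇ-suc-self : ∀ a → (a <ᵇ suc a) ≡ true
<ᵇ-suc-self a = <ᵇ-true⁺ (n<1+n a)

<ᵇ-suc : ∀ {a b} → a ≢ b → (a <ᵇ suc b) ≡ (a <ᵇ b)
<ᵇ-suc {a} {b} a≢b with <-cmp a b
... | tri< a<b _ _ rewrite <ᵇ-true⁺ a<b = <ᵇ-true⁺ (<-trans a<b (n<1+n b))
... | tri≈ _ a≡b _ = contradiction a≡b a≢b
... | tri> _ _ b<a rewrite <ᵇ-false⁺ (<⇒≤ b<a) = <ᵇ-false⁺ b<a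

<ᵇ-flip : ∀ {a b} → a ≢ b → (b <ᵇ a) ≡ not (a <ᵇ b)
<ᵇ-flip {a} {b} a≢b with <-cmp a b
... | tri< a<b _ _ rewrite <ᵇ-true⁺ a<b = <ᵇ-false⁺ (<⇒≤ a<b)
... | tri≈ _ a≡b _ = contradiction a≡b a≢b
... | tri> _ _ b<a rewrite <ᵇ-false⁺ (<⇒≤ b<a) = <ᵇ-true⁺ b<a

interval-xor : ∀ u v x → x ≢ u → x ≢ v →
  (((u <ᵇ x) ∧ (x <ᵇ v)) ∨ ((v <ᵇ x) ∧ (x <ᵇ u))) ≡ ((x <ᵇ u) xor (x <ᵇ v))
interval-xor u v x x≢u x≢v rewrite <ᵇ-flip x≢u | <ᵇ-flip x≢v with x <ᵇ u | x <ᵇ v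
... | true  | true  = refl
... | true  | false = refl
... | false | true  = refl
... | false | false = refl

module Endpoints {n} (D : ChordDiagram n) where
  open ChordDiagram D

  partner-injective : ∀ {p q} → partner p ≡ partner q → p ≡ q
  partner-injective {p} {q} eq = trans (sym (partner-invol p)) (trans (cong partner eq) (partner-invol q))

  fiberSize : Fin n → ℕ
  fiberSize d = ∑ (λ p → 𝟙 (eqF (chord p) d))

  empty-fiber : ∀ d → anyF (λ p → eqF (chord p) d) ≡ false → fiberSize d ≡ 0
  empty-fiber d no-endpoint = trans (ℕ-Sum.sum-cong-≗ (λ p → cong 𝟙 (not-endpoint p))) (ℕ-Sum.sum-replicate-zero (2 * n))
    where
    not-endpoint : ∀ p → eqF (chord p) d ≡ false
    not-endpoint p with eqF (chord p) d in e
    ... | false = refl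
    ... | true  = trans (sym (anyF-true⁺ (λ p → eqF (chord p) d) p e)) no-endpoint

  fiberSize≤2 : ∀ d → fiberSize d ≤ 2
  fiberSize≤2 d with anyF (λ p → eqF (chord p) d) in hit
  ... | false = subst (_≤ 2) (sym (empty-fiber d hit)) z≤n
  ... | true with anyF-true⁻ (λ p → eqF (chord p) d) hit
  ...   | p , cₚ≡d = begin
    ∑ (λ t → 𝟙 (eqF (chord t) d))                ≤⟨ ∑-mono-≤ (λ t → at-most-two t) ⟩
    ∑ (λ t → 𝟙 (eqF t p) + 𝟙 (eqF t (partner p))) ≡⟨ ℕ-Sum.∑-distrib-+ (λ t → 𝟙 (eqF t p)) _ ⟩
    ∑ (λ t → 𝟙 (eqF t p)) + ∑ (λ t → 𝟙 (eqF t (partner p))) ≡⟨ cong₂ _+_ (∑-indicator p) (∑-indicator (partner p)) ⟩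
    2                                            ∎
    where
    open ≤-Reasoning
    at-most-two : ∀ t → 𝟙 (eqF (chord t) d) ≤ 𝟙 (eqF t p) + 𝟙 (eqF t (partner p))
    at-most-two t with eqF (chord t) d in cₜ≡d
    ... | false = z≤n
    ... | true with chord-twice p t (trans (eqF-true⁻ cₚ≡d) (sym (eqF-true⁻ cₜ≡d)))
    ...   | inj₁ refl rewrite eqF-refl p = s≤s z≤n
    ...   | inj₂ refl rewrite eqF-refl (partner p) = m≤n+m 1 (𝟙 (eqF (partner p) p))

  ∑fiberSize : ∑ fiberSize ≡ 2 * n
  ∑fiberSize = begin
    ∑ (λ d → ∑ (λ p → 𝟙 (eqF (chord p) d)))   ≡⟨ ℕ-Sum.∑-comm (λ d p → 𝟙 (eqF (chord p) d)) ⟩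
    ∑ (λ p → ∑ (λ d → 𝟙 (eqF (chord p) d)))   ≡⟨ ℕ-Sum.sum-cong-≗ (λ p → one p) ⟩
    ∑ {2 * n} (λ _ → 1)                       ≡⟨ ∑-const {2 * n} 1 ⟩
    2 * n * 1                                 ≡⟨ *-identityʳ (2 * n) ⟩
    2 * n                                     ∎
    where
    open ≡-Reasoning
    one : ∀ p → ∑ (λ d → 𝟙 (eqF (chord p) d)) ≡ 1
    one p = trans (ℕ-Sum.sum-cong-≗ (λ d → cong 𝟙 (eqF-sym (chord p) d))) (∑-indicator (chord p))

  -- The 2n ends fall into fibres of size at most 2 over the n chords, so no fibre is empty.
  chord-surjective : ∀ d₀ → ∃ λ p → chord p ≡ d₀
  chord-surjective d₀ with anyF (λ p → eqF (chord p) d₀) in hit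
  ... | true  = let (p , cₚ≡d₀) = anyF-true⁻ (λ p → eqF (chord p) d₀) hit in p , eqF-true⁻ cₚ≡d₀
  ... | false = contradiction overfull (<⇒≱ (m<m+n (2 * n) z<s))
    where
    open ≤-Reasoning
    bounded : ∀ d → fiberSize d + 𝟙 (eqF d d₀) * 2 ≤ 2
    bounded d with eqF d d₀ in d≡d₀
    ... | true  = subst (λ k → k + 2 ≤ 2) (sym (trans (cong fiberSize (eqF-true⁻ d≡d₀)) (empty-fiber d₀ hit))) ≤-refl
    ... | false = subst (_≤ 2) (sym (+-identityʳ (fiberSize d))) (fiberSize≤2 d)
    overfull : 2 * n + 2 ≤ 2 * n
    overfull = begin
      2 * n + 2                                       ≡⟨ cong₂ _+_ ∑fiberSize (∑-select d₀ (λ _ → 2)) ⟨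
      ∑ fiberSize + ∑ (λ d → 𝟙 (eqF d d₀) * 2)        ≡⟨ ℕ-Sum.∑-distrib-+ fiberSize _ ⟨
      ∑ (λ d → fiberSize d + 𝟙 (eqF d d₀) * 2)        ≤⟨ ∑-mono-≤ bounded ⟩
      ∑ {n} (λ _ → 2)                                 ≡⟨ ∑-const {n} 2 ⟩
      n * 2                                           ≡⟨ *-comm n 2 ⟩
      2 * n                                           ∎

  endpoint : Fin n → Fin (2 * n)
  endpoint d = proj₁ (chord-surjective d)

  chord-endpoint : ∀ d → chord (endpoint d) ≡ d
  chord-endpoint d = proj₂ (chord-surjective d)

  chord-partner-endpoint : ∀ d → chord (partner (endpoint d)) ≡ d
  chord-partner-endpoint d = trans (partner-chord (endpoint d)) (chord-endpoint d)

  endpoints-of : ∀ {p d} → chord p ≡ d → p ≡ endpoint d ⊎ p ≡ partner (endpoint d)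
  endpoints-of cₚ≡d = chord-twice (endpoint _) _ (trans (chord-endpoint _) (sym cₚ≡d))

  eqF-chord : ∀ p d → eqF (chord p) d ≡ (eqF p (endpoint d) xor eqF p (partner (endpoint d)))
  eqF-chord p d with chord p Fin.≟ d
  ... | no cₚ≢d rewrite eqF-false⁺ (λ p≡e → cₚ≢d (trans (cong chord p≡e) (chord-endpoint d)))
                      | eqF-false⁺ (λ p≡e′ → cₚ≢d (trans (cong chord p≡e′) (chord-partner-endpoint d))) = refl
  ... | yes cₚ≡d with endpoints-of cₚ≡d
  ...   | inj₁ refl rewrite eqF-refl (endpoint d)
                          | eqF-false⁺ (λ e → partner-distinct (endpoint d) (sym e)) = refl
  ...   | inj₂ refl rewrite eqF-refl (partner (endpoint d))
                          | eqF-false⁺ (partner-distinct (endpoint d)) = refl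

  anyF-fiber : ∀ d (F : Fin (2 * n) → Bool) → (∀ q → chord q ≡ d → F q ≡ F (endpoint d)) →
    anyF (λ q → eqF (chord q) d ∧ F q) ≡ F (endpoint d)
  anyF-fiber d F F-constant with F (endpoint d) in Fₑ
  ... | true  = anyF-true⁺ (λ q → eqF (chord q) d ∧ F q) (endpoint d) (cong₂ _∧_ (eqF-true⁺ (chord-endpoint d)) Fₑ)
  ... | false = anyF-false⁺ (λ q → eqF (chord q) d ∧ F q) outside
    where
    outside : ∀ q → (eqF (chord q) d ∧ F q) ≡ false
    outside q with eqF (chord q) d in cq≡d
    ... | false = refl
    ... | true  = F-constant q (eqF-true⁻ cq≡d)

  ⨁-fiber : ∀ d (g : Fin (2 * n) → Bool) → ⨁ (λ t → eqF (chord t) d ∧ g t) ≡ (g (endpoint d) xor g (partner (endpoint d)))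
  ⨁-fiber d g = begin
    ⨁ (λ t → eqF (chord t) d ∧ g t)
      ≡⟨ 𝔽₂-Sum.sum-cong-≗ (λ t → trans (cong (_∧ g t) (eqF-chord t d)) (∧-distribʳ-xor (g t) (eqF t e) (eqF t e′))) ⟩
    ⨁ (λ t → (eqF t e ∧ g t) xor (eqF t e′ ∧ g t))
      ≡⟨ 𝔽₂-Sum.∑-distrib-+ (λ t → eqF t e ∧ g t) _ ⟩
    ⨁ (λ t → eqF t e ∧ g t) xor ⨁ (λ t → eqF t e′ ∧ g t)
      ≡⟨ cong₂ _xor_ (⨁-select e g) (⨁-select e′ g) ⟩
    g e xor g e′ ∎
    where
    open ≡-Reasoning
    e  = endpoint d
    e′ = partner (endpoint d)

  ⨁-by-chords : ∀ (h : Fin (2 * n) → Bool) (X : Subset n) →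
    ⨁ (λ t → h t ∧ lookup X (chord t)) ≡ ⨁ (λ d → lookup X d ∧ (h (endpoint d) xor h (partner (endpoint d))))
  ⨁-by-chords h X = begin
    ⨁ (λ t → h t ∧ lookup X (chord t))
      ≡⟨ 𝔽₂-Sum.sum-cong-≗ (λ t → cong (h t ∧_) (sym (⨁-select (chord t) (lookup X)))) ⟩
    ⨁ (λ t → h t ∧ ⨁ (λ d → eqF d (chord t) ∧ lookup X d))
      ≡⟨ 𝔽₂-Sum.sum-cong-≗ (λ t → 𝔽₂-Sum.*-distribˡ-sum (h t) (λ d → eqF d (chord t) ∧ lookup X d)) ⟩
    ⨁ (λ t → ⨁ (λ d → h t ∧ (eqF d (chord t) ∧ lookup X d)))
      ≡⟨ 𝔽₂-Sum.∑-comm (λ t d → h t ∧ (eqF d (chord t) ∧ lookup X d)) ⟩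
    ⨁ (λ d → ⨁ (λ t → h t ∧ (eqF d (chord t) ∧ lookup X d)))
      ≡⟨ 𝔽₂-Sum.sum-cong-≗ (λ d → 𝔽₂-Sum.sum-cong-≗ (λ t → rearrange (h t) (chord t) d (lookup X d))) ⟩
    ⨁ (λ d → ⨁ (λ t → lookup X d ∧ (eqF (chord t) d ∧ h t)))
      ≡⟨ 𝔽₂-Sum.sum-cong-≗ (λ d → sym (𝔽₂-Sum.*-distribˡ-sum (lookup X d) (λ t → eqF (chord t) d ∧ h t))) ⟩
    ⨁ (λ d → lookup X d ∧ ⨁ (λ t → eqF (chord t) d ∧ h t))
      ≡⟨ 𝔽₂-Sum.sum-cong-≗ (λ d → cong (lookup X d ∧_) (⨁-fiber d h)) ⟩
    ⨁ (λ d → lookup X d ∧ (h (endpoint d) xor h (partner (endpoint d)))) ∎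
    where
    open ≡-Reasoning
    rearrange : ∀ a c d x → (a ∧ (eqF d c ∧ x)) ≡ (x ∧ (eqF c d ∧ a))
    rearrange a c d x rewrite eqF-sym d c with eqF c d
    ... | true  = ∧-comm a x
    ... | false = trans (∧-zeroʳ a) (sym (∧-zeroʳ x))

module Interlacing {n} (D : ChordDiagram n) where
  open ChordDiagram D
  open Endpoints D

  between : Fin (2 * n) → Fin (2 * n) → Bool
  between = strictlyBetween D

  between-partner : ∀ p t → between (partner p) t ≡ between p t
  between-partner p t rewrite partner-invol p =
    ∨-comm ((toℕ (partner p) <ᵇ toℕ t) ∧ (toℕ t <ᵇ toℕ p)) ((toℕ p <ᵇ toℕ t) ∧ (toℕ t <ᵇ toℕ (partner p)))

  between-self : ∀ p → between p p ≡ false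
  between-self p rewrite <ᵇ-irrefl (toℕ p) = ∧-zeroʳ _

  between-self-partner : ∀ p → between p (partner p) ≡ false
  between-self-partner p rewrite <ᵇ-irrefl (toℕ (partner p)) = cong (_∨ false) (∧-zeroʳ _)

  between-xor : ∀ p t → t ≢ p → t ≢ partner p →
    between p t ≡ ((toℕ t <ᵇ toℕ p) xor (toℕ t <ᵇ toℕ (partner p)))
  between-xor p t t≢p t≢p′ = interval-xor (toℕ p) (toℕ (partner p)) (toℕ t) (toℕ-≢ t≢p) (toℕ-≢ t≢p′)

  between-endpoint : ∀ {p c} t → chord p ≡ c → between p t ≡ between (endpoint c) t
  between-endpoint t cₚ≡c with endpoints-of cₚ≡c
  ... | inj₁ refl = refl
  ... | inj₂ refl = between-partner (endpoint _) t

  interlaced : Fin n → Fin n → Bool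
  interlaced c d = between (endpoint c) (endpoint d) xor between (endpoint c) (partner (endpoint d))

  intersect≡interlaced : ∀ c d → intersect D c d ≡ interlaced c d
  intersect≡interlaced c d = begin
    anyF (λ p → anyF (λ q → eqF (chord p) c ∧ eqF (chord q) d ∧ crossing p q))
      ≡⟨ anyF-cong _ _ (λ p → anyF-∧ˡ (eqF (chord p) c) (λ q → eqF (chord q) d ∧ crossing p q)) ⟩
    anyF (λ p → eqF (chord p) c ∧ anyF (λ q → eqF (chord q) d ∧ crossing p q))
      ≡⟨ anyF-cong _ _ (λ p → cong (eqF (chord p) c ∧_) (anyF-fiber d (crossing p) (crossing-fiber p))) ⟩
    anyF (λ p → eqF (chord p) c ∧ crossing p (endpoint d))
      ≡⟨ anyF-fiber c (λ p → crossing p (endpoint d))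
           (λ p cₚ≡c → cong₂ _xor_ (between-endpoint (endpoint d) cₚ≡c) (between-endpoint (partner (endpoint d)) cₚ≡c)) ⟩
    interlaced c d ∎
    where
    open ≡-Reasoning
    crossing : Fin (2 * n) → Fin (2 * n) → Bool
    crossing p q = between p q xor between p (partner q)
    crossing-fiber : ∀ p q → chord q ≡ d → crossing p q ≡ crossing p (endpoint d)
    crossing-fiber p q cq≡d with endpoints-of cq≡d
    ... | inj₁ refl = refl
    ... | inj₂ refl rewrite partner-invol (endpoint d) = xor-comm (between p (partner (endpoint d))) _

  interlaced-sym : ∀ c d → interlaced c d ≡ interlaced d c
  interlaced-sym c d with c Fin.≟ d
  ... | yes refl = refl
  ... | no c≢d = begin
    between e₁ f₁ xor between e₁ f₂
      ≡⟨ cong₂ _xor_ (between-xor e₁ f₁ (f≢e f₁-chord e₁-chord) (f≢e f₁-chord e₂-chord))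
                     (between-xor e₁ f₂ (f≢e f₂-chord e₁-chord) (f≢e f₂-chord e₂-chord)) ⟩
    ((b₁ <ᵇ a₁) xor (b₁ <ᵇ a₂)) xor ((b₂ <ᵇ a₁) xor (b₂ <ᵇ a₂))
      ≡⟨ xor-interchange (b₁ <ᵇ a₁) (b₁ <ᵇ a₂) (b₂ <ᵇ a₁) (b₂ <ᵇ a₂) ⟩
    ((b₁ <ᵇ a₁) xor (b₂ <ᵇ a₁)) xor ((b₁ <ᵇ a₂) xor (b₂ <ᵇ a₂))
      ≡⟨ cong₂ _xor_ (xor-annihilates-not (b₁ <ᵇ a₁) (b₂ <ᵇ a₁)) (xor-annihilates-not (b₁ <ᵇ a₂) (b₂ <ᵇ a₂)) ⟨
    (not (b₁ <ᵇ a₁) xor not (b₂ <ᵇ a₁)) xor (not (b₁ <ᵇ a₂) xor not (b₂ <ᵇ a₂))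
      ≡⟨ cong₂ _xor_ (cong₂ _xor_ (flip f₁-chord e₁-chord) (flip f₂-chord e₁-chord))
                     (cong₂ _xor_ (flip f₁-chord e₂-chord) (flip f₂-chord e₂-chord)) ⟨
    ((a₁ <ᵇ b₁) xor (a₁ <ᵇ b₂)) xor ((a₂ <ᵇ b₁) xor (a₂ <ᵇ b₂))
      ≡⟨ cong₂ _xor_ (between-xor f₁ e₁ (e≢f e₁-chord f₁-chord) (e≢f e₁-chord f₂-chord))
                     (between-xor f₁ e₂ (e≢f e₂-chord f₁-chord) (e≢f e₂-chord f₂-chord)) ⟨
    between f₁ e₁ xor between f₁ e₂ ∎
    where
    open ≡-Reasoning
    e₁ = endpoint c
    e₂ = partner (endpoint c)
    f₁ = endpoint d
    f₂ = partner (endpoint d)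
    a₁ = toℕ e₁
    a₂ = toℕ e₂
    b₁ = toℕ f₁
    b₂ = toℕ f₂
    e₁-chord = chord-endpoint c
    e₂-chord = chord-partner-endpoint c
    f₁-chord = chord-endpoint d
    f₂-chord = chord-partner-endpoint d
    e≢f : ∀ {e f} → chord e ≡ c → chord f ≡ d → e ≢ f
    e≢f ce≡c cf≡d e≡f = c≢d (trans (sym ce≡c) (trans (cong chord e≡f) cf≡d))
    f≢e : ∀ {f e} → chord f ≡ d → chord e ≡ c → f ≢ e
    f≢e cf≡d ce≡c f≡e = e≢f ce≡c cf≡d (sym f≡e)
    flip : ∀ {f e} → chord f ≡ d → chord e ≡ c → (toℕ e <ᵇ toℕ f) ≡ not (toℕ f <ᵇ toℕ e)
    flip cf≡d ce≡c = <ᵇ-flip (toℕ-≢ (f≢e cf≡d ce≡c))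

  intersect-sym : ∀ c d → intersect D c d ≡ intersect D d c
  intersect-sym c d = trans (intersect≡interlaced c d) (trans (interlaced-sym c d) (sym (intersect≡interlaced d c)))

  prefixParity : Subset n → Fin (2 * n) → Bool
  prefixParity X s = ⨁ (λ t → (toℕ t <ᵇ toℕ s) ∧ lookup X (chord t))

  -- A chord has an odd number of ends strictly between s and its partner iff it crosses the chord of s.
  crossings-parity : ∀ X s → ⨁ (λ t → between s t ∧ lookup X (chord t)) ≡ rowSum (intersect D) X (chord s)
  crossings-parity X s = begin
    ⨁ (λ t → between s t ∧ lookup X (chord t))
      ≡⟨ ⨁-by-chords (between s) X ⟩
    ⨁ (λ d → lookup X d ∧ (between s (endpoint d) xor between s (partner (endpoint d))))
      ≡⟨ 𝔽₂-Sum.sum-cong-≗ (λ d → cong (lookup X d ∧_) (crossing d)) ⟩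
    ⨁ (λ d → lookup X d ∧ intersect D d (chord s))
      ≡⟨ rowSum≡⨁ (intersect D) X (chord s) ⟨
    rowSum (intersect D) X (chord s) ∎
    where
    open ≡-Reasoning
    crossing : ∀ d → (between s (endpoint d) xor between s (partner (endpoint d))) ≡ intersect D d (chord s)
    crossing d = begin
      between s (endpoint d) xor between s (partner (endpoint d))
        ≡⟨ cong₂ _xor_ (between-endpoint (endpoint d) refl) (between-endpoint (partner (endpoint d)) refl) ⟩
      interlaced (chord s) d  ≡⟨ intersect≡interlaced (chord s) d ⟨
      intersect D (chord s) d ≡⟨ intersect-sym (chord s) d ⟩
      intersect D d (chord s) ∎

  before-exactly-one : ∀ X s t →
    (((toℕ t <ᵇ toℕ s) xor (toℕ t <ᵇ toℕ (partner s))) ∧ lookup X (chord t))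
      ≡ ((between s t ∧ lookup X (chord t))
         xor ((eqF t s ∧ ((toℕ s <ᵇ toℕ (partner s)) ∧ lookup X (chord s)))
              xor (eqF t (partner s) ∧ ((toℕ (partner s) <ᵇ toℕ s) ∧ lookup X (chord s)))))
  before-exactly-one X s t = by-cases t (t Fin.≟ s) (t Fin.≟ partner s)
    where
    open ≡-Reasoning
    s′ = partner s
    x : Fin (2 * n) → Bool
    x t = lookup X (chord t)
    s<s′ = toℕ s <ᵇ toℕ s′
    s′<s = toℕ s′ <ᵇ toℕ s
    s≢s′ : s ≢ s′
    s≢s′ s≡s′ = partner-distinct s (sym s≡s′)
    by-cases : ∀ t → Dec (t ≡ s) → Dec (t ≡ s′) →
      (((toℕ t <ᵇ toℕ s) xor (toℕ t <ᵇ toℕ s′)) ∧ x t)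
        ≡ ((between s t ∧ x t) xor ((eqF t s ∧ (s<s′ ∧ x s)) xor (eqF t s′ ∧ (s′<s ∧ x s))))
    by-cases t (yes refl) _ = begin
      ((toℕ s <ᵇ toℕ s) xor s<s′) ∧ x s
        ≡⟨ cong (λ b → (b xor s<s′) ∧ x s) (<ᵇ-irrefl (toℕ s)) ⟩
      s<s′ ∧ x s
        ≡⟨ xor-identityʳ (s<s′ ∧ x s) ⟨
      (s<s′ ∧ x s) xor (false ∧ (s′<s ∧ x s))
        ≡⟨ cong₂ (λ a b → (a ∧ (s<s′ ∧ x s)) xor (b ∧ (s′<s ∧ x s))) (eqF-refl s) (eqF-false⁺ s≢s′) ⟨
      (eqF s s ∧ (s<s′ ∧ x s)) xor (eqF s s′ ∧ (s′<s ∧ x s))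
        ≡⟨ cong (λ b → (b ∧ x s) xor ((eqF s s ∧ (s<s′ ∧ x s)) xor (eqF s s′ ∧ (s′<s ∧ x s)))) (between-self s) ⟨
      (between s s ∧ x s) xor ((eqF s s ∧ (s<s′ ∧ x s)) xor (eqF s s′ ∧ (s′<s ∧ x s))) ∎
    by-cases t (no t≢s) (yes refl) = begin
      (s′<s xor (toℕ s′ <ᵇ toℕ s′)) ∧ x s′
        ≡⟨ cong (λ b → (s′<s xor b) ∧ x s′) (<ᵇ-irrefl (toℕ s′)) ⟩
      (s′<s xor false) ∧ x s′
        ≡⟨ cong₂ _∧_ (xor-identityʳ s′<s) (cong (lookup X) (partner-chord s)) ⟩
      s′<s ∧ x s
        ≡⟨ cong₂ (λ a b → (a ∧ (s<s′ ∧ x s)) xor (b ∧ (s′<s ∧ x s))) (eqF-false⁺ t≢s) (eqF-refl s′) ⟨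
      (eqF s′ s ∧ (s<s′ ∧ x s)) xor (eqF s′ s′ ∧ (s′<s ∧ x s))
        ≡⟨ cong (λ b → (b ∧ x s′) xor ((eqF s′ s ∧ (s<s′ ∧ x s)) xor (eqF s′ s′ ∧ (s′<s ∧ x s)))) (between-self-partner s) ⟨
      (between s s′ ∧ x s′) xor ((eqF s′ s ∧ (s<s′ ∧ x s)) xor (eqF s′ s′ ∧ (s′<s ∧ x s))) ∎
    by-cases t (no t≢s) (no t≢s′) = begin
      ((toℕ t <ᵇ toℕ s) xor (toℕ t <ᵇ toℕ s′)) ∧ x t
        ≡⟨ cong (_∧ x t) (between-xor s t t≢s t≢s′) ⟨
      between s t ∧ x t
        ≡⟨ xor-identityʳ (between s t ∧ x t) ⟨
      (between s t ∧ x t) xor false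
        ≡⟨ cong₂ (λ a b → (between s t ∧ x t) xor ((a ∧ (s<s′ ∧ x s)) xor (b ∧ (s′<s ∧ x s)))) (eqF-false⁺ t≢s) (eqF-false⁺ t≢s′) ⟨
      (between s t ∧ x t) xor ((eqF t s ∧ (s<s′ ∧ x s)) xor (eqF t s′ ∧ (s′<s ∧ x s))) ∎

  parity-across-chord : ∀ X s →
    (prefixParity X s xor prefixParity X (partner s)) ≡ (lookup X (chord s) xor rowSum (intersect D) X (chord s))
  parity-across-chord X s = begin
    prefixParity X s xor prefixParity X s′
      ≡⟨ 𝔽₂-Sum.∑-distrib-+ (λ t → (toℕ t <ᵇ toℕ s) ∧ x t) _ ⟨
    ⨁ (λ t → ((toℕ t <ᵇ toℕ s) ∧ x t) xor ((toℕ t <ᵇ toℕ s′) ∧ x t))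
      ≡⟨ 𝔽₂-Sum.sum-cong-≗ (λ t → trans (sym (∧-distribʳ-xor (x t) (toℕ t <ᵇ toℕ s) _)) (before-exactly-one X s t)) ⟩
    ⨁ (λ t → (between s t ∧ x t) xor ((eqF t s ∧ (s<s′ ∧ x s)) xor (eqF t s′ ∧ (s′<s ∧ x s))))
      ≡⟨ trans (𝔽₂-Sum.∑-distrib-+ (λ t → between s t ∧ x t) _)
               (cong (⨁ (λ t → between s t ∧ x t) xor_) (𝔽₂-Sum.∑-distrib-+ (λ t → eqF t s ∧ (s<s′ ∧ x s)) _)) ⟩
    ⨁ (λ t → between s t ∧ x t) xor (⨁ (λ t → eqF t s ∧ (s<s′ ∧ x s)) xor ⨁ (λ t → eqF t s′ ∧ (s′<s ∧ x s)))
      ≡⟨ cong₂ _xor_ (crossings-parity X s)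
                     (trans (cong₂ _xor_ (⨁-select s (λ _ → s<s′ ∧ x s)) (⨁-select s′ (λ _ → s′<s ∧ x s))) exactly-one) ⟩
    rowSum (intersect D) X (chord s) xor x s
      ≡⟨ xor-comm _ (x s) ⟩
    x s xor rowSum (intersect D) X (chord s) ∎
    where
    open ≡-Reasoning
    s′ = partner s
    x : Fin (2 * n) → Bool
    x t = lookup X (chord t)
    s<s′ = toℕ s <ᵇ toℕ s′
    s′<s = toℕ s′ <ᵇ toℕ s
    exactly-one : ((s<s′ ∧ x s) xor (s′<s ∧ x s)) ≡ x s
    exactly-one rewrite <ᵇ-flip {toℕ s} {toℕ s′} (toℕ-≢ (λ s≡s′ → partner-distinct s (sym s≡s′))) with s<s′
    ... | true  = xor-identityʳ (x s)
    ... | false = refl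

  total-parity : ∀ X → ⨁ (λ t → lookup X (chord t)) ≡ false
  total-parity X = trans (⨁-by-chords (λ _ → true) X)
    (⨁-zero (λ d → trans (cong (lookup X d ∧_) (xor-same true)) (∧-zeroʳ (lookup X d))))

-- Partial duals of the one-vertex ribbon graph

data NextView {m} (i : Fin (suc m)) : Set where
  step : suc (toℕ i) < suc m → toℕ (next i) ≡ suc (toℕ i) → NextView i
  wrap : suc (toℕ i) ≡ suc m → toℕ (next i) ≡ 0 → NextView i

next-view : ∀ {m} (i : Fin (suc m)) → NextView i
next-view {m} i with suc (toℕ i) <? suc m
... | yes i+1<m = step i+1<m (trans (toℕ-fromℕ< _) (m<n⇒m%n≡m i+1<m))
... | no  i+1≮m = wrap i+1≡m (trans (toℕ-fromℕ< _) (trans (cong (_% suc m) i+1≡m) (n%n≡0 (suc m))))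
  where
  i+1≡m : suc (toℕ i) ≡ suc m
  i+1≡m = ≤-antisym (toℕ<n i) (≮⇒≥ i+1≮m)

next-injective : ∀ {m} {i j : Fin (suc m)} → next i ≡ next j → i ≡ j
next-injective {i = i} {j} eq with next-view i | next-view j
... | step _ i′ | step _ j′ = toℕ-injective (suc-injective (trans (sym i′) (trans (cong toℕ eq) j′)))
... | wrap i+1 _ | wrap j+1 _ = toℕ-injective (suc-injective (trans i+1 (sym j+1)))
... | step _ i′ | wrap _ j′ = contradiction (trans (sym j′) (trans (cong toℕ (sym eq)) i′)) 0≢1+n
... | wrap _ i′ | step _ j′ = contradiction (trans (sym i′) (trans (cong toℕ eq) j′)) 0≢1+n

toℕ-next^ : ∀ {m} k → k < suc m → toℕ (iter k next (zero {m})) ≡ k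
toℕ-next^ zero    _     = refl
toℕ-next^ (suc k) k+1<m with next-view (iter k next zero) | toℕ-next^ k (<-trans (n<1+n k) k+1<m)
... | step _ next≡ | ih = trans next≡ (cong suc ih)
... | wrap last _  | ih = contradiction (trans (cong suc (sym ih)) last) (<⇒≢ k+1<m)

next^-toℕ : ∀ {m} (s : Fin (suc m)) → iter (toℕ s) next zero ≡ s
next^-toℕ s = toℕ-injective (toℕ-next^ (toℕ s) (toℕ<n s))

<ᵇ-suc-xor : ∀ {m} (t s : Fin m) → (toℕ t <ᵇ suc (toℕ s)) ≡ ((toℕ t <ᵇ toℕ s) xor eqF t s)
<ᵇ-suc-xor t s with t Fin.≟ s
... | yes refl = trans (<ᵇ-suc-self (toℕ t)) (sym (cong (_xor true) (<ᵇ-irrefl (toℕ t))))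
... | no  t≢s  = trans (<ᵇ-suc (toℕ-≢ t≢s)) (sym (xor-identityʳ _))

<ᵇ-last : ∀ {m} (t s : Fin (suc m)) → suc (toℕ s) ≡ suc m → (toℕ t <ᵇ toℕ s) ≡ not (eqF t s)
<ᵇ-last t s last with t Fin.≟ s
... | yes refl = <ᵇ-irrefl (toℕ t)
... | no  t≢s  = <ᵇ-true⁺ (≤∧≢⇒< (≤-pred (subst (toℕ t <_) (sym last) (toℕ<n t))) (toℕ-≢ t≢s))

reach-suc : ∀ {m} (σ α : Fin m → Fin m) i t j → reach σ α i t j ≡ true → reach σ α i (suc t) j ≡ true
reach-suc σ α i t j h rewrite h = refl

reach-mono : ∀ {m} (σ α : Fin m → Fin m) i {t t′} j → t ≤ t′ → reach σ α i t j ≡ true → reach σ α i t′ j ≡ true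
reach-mono σ α i {t} {t′} j t≤t′ h = subst (λ u → reach σ α i u j ≡ true) (m∸n+n≡m t≤t′) (later (t′ ∸ t))
  where
  later : ∀ d → reach σ α i (d + t) j ≡ true
  later zero    = h
  later (suc d) = reach-suc σ α i (d + t) j (later d)

reach-step : ∀ {m} (σ α : Fin m → Fin m) i t k j → reach σ α i t k ≡ true → (eqF (σ k) j ∨ eqF (α k) j) ≡ true →
  reach σ α i (suc t) j ≡ true
reach-step σ α i t k j reached edge =
  trans (cong (reach σ α i t j ∨_)
          (anyF-true⁺ (λ k′ → reach σ α i t k′ ∧ (eqF (σ k′) j ∨ eqF (α k′) j)) k (cong₂ _∧_ reached edge)))
        (∨-zeroʳ (reach σ α i t j))

reach-iterate : ∀ {m} (σ α : Fin m → Fin m) i k → reach σ α i k (iter k σ i) ≡ true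
reach-iterate σ α i zero    = eqF-refl i
reach-iterate σ α i (suc k) = reach-step σ α i k (iter k σ i) (iter (suc k) σ i) (reach-iterate σ α i k)
  (cong (_∨ eqF (α (iter k σ i)) (iter (suc k) σ i)) (eqF-refl (iter (suc k) σ i)))

module ChordRibbonGraph {n} (D : ChordDiagram (suc n)) where
  open ChordDiagram D
  open Endpoints D
  open Interlacing D

  prefixParity-zero : ∀ X → prefixParity X zero ≡ false
  prefixParity-zero X = ⨁-zero {f = λ t → (toℕ t <ᵇ 0) ∧ lookup X (chord t)} (λ _ → refl)

  prefixParity-last : ∀ X s → suc (toℕ s) ≡ 2 * suc n → prefixParity X s ≡ lookup X (chord s)
  prefixParity-last X s last = begin
    prefixParity X s                   ≡⟨ 𝔽₂-Sum.sum-cong-≗ all-but-last ⟨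
    ⨁ (λ t → x t xor (eqF t s ∧ x t))  ≡⟨ 𝔽₂-Sum.∑-distrib-+ x (λ t → eqF t s ∧ x t) ⟩
    ⨁ x xor ⨁ (λ t → eqF t s ∧ x t)    ≡⟨ cong₂ _xor_ (total-parity X) (⨁-select s x) ⟩
    x s                                ∎
    where
    open ≡-Reasoning
    x : Fin (2 * suc n) → Bool
    x t = lookup X (chord t)
    all-but-last : ∀ t → (x t xor (eqF t s ∧ x t)) ≡ ((toℕ t <ᵇ toℕ s) ∧ x t)
    all-but-last t rewrite <ᵇ-last t s last with eqF t s
    ... | true  = xor-same (x t)
    ... | false = xor-identityʳ (x t)

  prefixParity-next : ∀ X s → prefixParity X (next s) ≡ (prefixParity X s xor lookup X (chord s))
  prefixParity-next X s with next-view s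
  ... | step _ next≡ = begin
    ⨁ (λ t → (toℕ t <ᵇ toℕ (next s)) ∧ x t)
      ≡⟨ 𝔽₂-Sum.sum-cong-≗ (λ t → cong (λ b → (toℕ t <ᵇ b) ∧ x t) next≡) ⟩
    ⨁ (λ t → (toℕ t <ᵇ suc (toℕ s)) ∧ x t)
      ≡⟨ 𝔽₂-Sum.sum-cong-≗ (λ t → trans (cong (_∧ x t) (<ᵇ-suc-xor t s)) (∧-distribʳ-xor (x t) (toℕ t <ᵇ toℕ s) (eqF t s))) ⟩
    ⨁ (λ t → ((toℕ t <ᵇ toℕ s) ∧ x t) xor (eqF t s ∧ x t))
      ≡⟨ 𝔽₂-Sum.∑-distrib-+ (λ t → (toℕ t <ᵇ toℕ s) ∧ x t) (λ t → eqF t s ∧ x t) ⟩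
    prefixParity X s xor ⨁ (λ t → eqF t s ∧ x t)
      ≡⟨ cong (prefixParity X s xor_) (⨁-select s x) ⟩
    prefixParity X s xor x s ∎
    where
    open ≡-Reasoning
    x : Fin (2 * suc n) → Bool
    x t = lookup X (chord t)
  ... | wrap last next≡0 = begin
    prefixParity X (next s)                   ≡⟨ ⨁-zero (λ t → cong (λ b → (toℕ t <ᵇ b) ∧ lookup X (chord t)) next≡0) ⟩
    false                                     ≡⟨ xor-same (lookup X (chord s)) ⟨
    lookup X (chord s) xor lookup X (chord s) ≡⟨ cong (_xor lookup X (chord s)) (prefixParity-last X s last) ⟨
    prefixParity X s xor lookup X (chord s)   ∎
    where open ≡-Reasoning

  module PartialDual (A : Subset (suc n)) where

    αA : Fin (2 * suc n) → Fin (2 * suc n)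
    αA p = if lookup A (chord p) then partner p else p

    π : Fin (2 * suc n) → Fin (2 * suc n)
    π p = next (αA p)

    chord-αA : ∀ p → chord (αA p) ≡ chord p
    chord-αA p with lookup A (chord p)
    ... | true  = partner-chord p
    ... | false = refl

    αA-involutive : ∀ p → αA (αA p) ≡ p
    αA-involutive p with lookup A (chord p) in Aₚ
    ... | true  rewrite partner-chord p | Aₚ = partner-invol p
    ... | false rewrite Aₚ = refl

    Invariant : Subset (2 * suc n) → Set
    Invariant ℓ = ∀ p → lookup ℓ (π p) ≡ lookup ℓ p

    π-injective : ∀ {p q} → π p ≡ π q → p ≡ q
    π-injective {p} {q} eq = trans (sym (αA-involutive p)) (trans (cong αA (next-injective eq)) (αA-involutive q))

    Φ : Subset (2 * suc n) → Subset (suc n)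
    Φ ℓ = tabulate (λ d → lookup A d ∧ (lookup ℓ (endpoint d) xor lookup ℓ (partner (endpoint d))))

    lookup-Φ : ∀ ℓ d → lookup (Φ ℓ) d ≡ (lookup A d ∧ (lookup ℓ (endpoint d) xor lookup ℓ (partner (endpoint d))))
    lookup-Φ ℓ = lookup∘tabulate (λ d → lookup A d ∧ (lookup ℓ (endpoint d) xor lookup ℓ (partner (endpoint d))))

    Φ-chord : ∀ ℓ s → lookup (Φ ℓ) (chord s) ≡ (lookup A (chord s) ∧ (lookup ℓ s xor lookup ℓ (partner s)))
    Φ-chord ℓ s = trans (lookup-Φ ℓ (chord s)) (cong (lookup A (chord s) ∧_) (ends (endpoints-of {s} refl)))
      where
      e = endpoint (chord s)
      ends : s ≡ e ⊎ s ≡ partner e → (lookup ℓ e xor lookup ℓ (partner e)) ≡ (lookup ℓ s xor lookup ℓ (partner s))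
      ends (inj₁ s≡e)  = cong (λ q → lookup ℓ q xor lookup ℓ (partner q)) (sym s≡e)
      ends (inj₂ s≡e′) = trans (xor-comm (lookup ℓ e) (lookup ℓ (partner e)))
        (cong₂ (λ a b → lookup ℓ a xor lookup ℓ b) (sym s≡e′) (trans (sym (partner-invol e)) (cong partner (sym s≡e′))))

    invariant-step : ∀ ℓ → Invariant ℓ →
      ∀ s → lookup ℓ (next s) ≡ (lookup ℓ s xor lookup (Φ ℓ) (chord s))
    invariant-step ℓ invariant s = begin
      lookup ℓ (next s)                ≡⟨ cong (lookup ℓ ∘ next) (αA-involutive s) ⟨
      lookup ℓ (π (αA s))              ≡⟨ invariant (αA s) ⟩
      lookup ℓ (αA s)                  ≡⟨ crossing ⟩
      lookup ℓ s xor (lookup A (chord s) ∧ (lookup ℓ s xor lookup ℓ (partner s)))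
                                       ≡⟨ cong (lookup ℓ s xor_) (Φ-chord ℓ s) ⟨
      lookup ℓ s xor lookup (Φ ℓ) (chord s) ∎
      where
      open ≡-Reasoning
      crossing : lookup ℓ (αA s) ≡ (lookup ℓ s xor (lookup A (chord s) ∧ (lookup ℓ s xor lookup ℓ (partner s))))
      crossing with lookup A (chord s)
      ... | false = sym (xor-identityʳ (lookup ℓ s))
      ... | true with lookup ℓ s | lookup ℓ (partner s)
      ...   | true  | true  = refl
      ...   | true  | false = refl
      ...   | false | true  = refl
      ...   | false | false = refl

    invariant⇒prefixParity : ∀ ℓ → Invariant ℓ × lookup ℓ zero ≡ false →
      ∀ s → prefixParity (Φ ℓ) s ≡ lookup ℓ s
    invariant⇒prefixParity ℓ (invariant , ℓ₀) s = subst (λ s → prefixParity (Φ ℓ) s ≡ lookup ℓ s) (next^-toℕ s) (along (toℕ s))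
      where
      along : ∀ k → prefixParity (Φ ℓ) (iter k next zero) ≡ lookup ℓ (iter k next zero)
      along zero    = trans (prefixParity-zero (Φ ℓ)) (sym ℓ₀)
      along (suc k) = trans (prefixParity-next (Φ ℓ) (iter k next zero))
        (trans (cong (_xor lookup (Φ ℓ) (chord (iter k next zero))) (along k))
               (sym (invariant-step ℓ invariant (iter k next zero))))

    open Z₂Rank (intersect D) A using (Vanishes; kernelᵇ; kernelᵇ⁺; kernelᵇ⁻; #kernel*2^rank)

    kernel⇒invariant : ∀ X → X ⊆ˢ A → Vanishes X → ∀ p → prefixParity X (π p) ≡ prefixParity X p
    kernel⇒invariant X X⊆A X-vanishes p =
      trans (prefixParity-next X (αA p)) (trans (cong (λ c → prefixParity X (αA p) xor lookup X c) (chord-αA p)) crossing)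
      where
      crossing : (prefixParity X (αA p) xor lookup X (chord p)) ≡ prefixParity X p
      crossing with lookup A (chord p) in Aₚ
      ... | false rewrite ⊆ˢ-∉ X A X⊆A (chord p) Aₚ = xor-identityʳ (prefixParity X p)
      ... | true = begin
        prefixParity X (partner p) xor lookup X (chord p)
          ≡⟨ cong (prefixParity X (partner p) xor_) across ⟨
        prefixParity X (partner p) xor (prefixParity X p xor prefixParity X (partner p))
          ≡⟨ xor-cancel-middle (prefixParity X p) (prefixParity X (partner p)) ⟩
        prefixParity X p ∎
        where
        open ≡-Reasoning
        across : (prefixParity X p xor prefixParity X (partner p)) ≡ lookup X (chord p)
        across = trans (parity-across-chord X p)
          (trans (cong (lookup X (chord p) xor_) (X-vanishes (chord p) Aₚ)) (xor-identityʳ (lookup X (chord p))))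
        xor-cancel-middle : ∀ a b → (b xor (a xor b)) ≡ a
        xor-cancel-middle true  true  = refl
        xor-cancel-middle true  false = refl
        xor-cancel-middle false true  = refl
        xor-cancel-middle false false = refl

    labelling : Subset (suc n) → Subset (2 * suc n)
    labelling X = tabulate (prefixParity X)

    lookup-labelling : ∀ X s → lookup (labelling X) s ≡ prefixParity X s
    lookup-labelling X = lookup∘tabulate (prefixParity X)

    rooted : Subset (2 * suc n) → Bool
    rooted ℓ = invariantᵇ π ℓ ∧ not (lookup ℓ zero)

    rooted⁻ : ∀ ℓ → rooted ℓ ≡ true → Invariant ℓ × lookup ℓ zero ≡ false
    rooted⁻ ℓ h = invariantᵇ⁻ π ℓ (proj₁ (∧-true⁻ h)) , not-injective (proj₂ (∧-true⁻ {invariantᵇ π ℓ} h))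

    labelling-invariant : ∀ X → X ⊆ˢ A → Vanishes X → Invariant (labelling X)
    labelling-invariant X X⊆A X-vanishes p = trans (lookup-labelling X (π p))
      (trans (kernel⇒invariant X X⊆A X-vanishes p) (sym (lookup-labelling X p)))

    Φ∘labelling : ∀ X → X ⊆ˢ A → Vanishes X → Φ (labelling X) ≡ X
    Φ∘labelling X X⊆A X-vanishes = lookup-ext λ d → begin
      lookup (Φ (labelling X)) d
        ≡⟨ lookup-Φ (labelling X) d ⟩
      lookup A d ∧ (lookup (labelling X) (endpoint d) xor lookup (labelling X) (partner (endpoint d)))
        ≡⟨ cong (lookup A d ∧_) (cong₂ _xor_ (lookup-labelling X (endpoint d)) (lookup-labelling X (partner (endpoint d)))) ⟩
      lookup A d ∧ (prefixParity X (endpoint d) xor prefixParity X (partner (endpoint d)))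
        ≡⟨ cong (lookup A d ∧_) (trans (parity-across-chord X (endpoint d))
                                       (cong (λ c → lookup X c xor rowSum (intersect D) X c) (chord-endpoint d))) ⟩
      lookup A d ∧ (lookup X d xor rowSum (intersect D) X d)
        ≡⟨ restrict d ⟩
      lookup X d ∎
      where
      open ≡-Reasoning
      restrict : ∀ d → (lookup A d ∧ (lookup X d xor rowSum (intersect D) X d)) ≡ lookup X d
      restrict d with lookup A d in A-d
      ... | true  = trans (cong (lookup X d xor_) (X-vanishes d A-d)) (xor-identityʳ (lookup X d))
      ... | false = sym (⊆ˢ-∉ X A X⊆A d A-d)

    Φ-kernel : ∀ ℓ → Invariant ℓ × lookup ℓ zero ≡ false → kernelᵇ (Φ ℓ) ≡ true
    Φ-kernel ℓ rooted-ℓ = kernelᵇ⁺ (Φ ℓ) Φℓ⊆A vanishes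
      where
      Φℓ⊆A : Φ ℓ ⊆ˢ A
      Φℓ⊆A d Φℓ-d = proj₁ (∧-true⁻ (trans (sym (lookup-Φ ℓ d)) Φℓ-d))
      absorbed : ∀ {x r} → x ≡ (x xor r) → r ≡ false
      absorbed {true}  {false} _ = refl
      absorbed {false} {false} _ = refl
      vanishes : Vanishes (Φ ℓ)
      vanishes j A-j = absorbed (begin
        lookup (Φ ℓ) j
          ≡⟨ lookup-Φ ℓ j ⟩
        lookup A j ∧ (lookup ℓ (endpoint j) xor lookup ℓ (partner (endpoint j)))
          ≡⟨ cong (_∧ (lookup ℓ (endpoint j) xor lookup ℓ (partner (endpoint j)))) A-j ⟩
        lookup ℓ (endpoint j) xor lookup ℓ (partner (endpoint j))
          ≡⟨ cong₂ _xor_ (invariant⇒prefixParity ℓ rooted-ℓ (endpoint j)) (invariant⇒prefixParity ℓ rooted-ℓ (partner (endpoint j))) ⟨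
        prefixParity (Φ ℓ) (endpoint j) xor prefixParity (Φ ℓ) (partner (endpoint j))
          ≡⟨ parity-across-chord (Φ ℓ) (endpoint j) ⟩
        lookup (Φ ℓ) (chord (endpoint j)) xor rowSum (intersect D) (Φ ℓ) (chord (endpoint j))
          ≡⟨ cong (λ c → lookup (Φ ℓ) c xor rowSum (intersect D) (Φ ℓ) c) (chord-endpoint j) ⟩
        lookup (Φ ℓ) j xor rowSum (intersect D) (Φ ℓ) j ∎)
        where open ≡-Reasoning

    rooted≅kernel : rooted ≅ˢ kernelᵇ
    rooted≅kernel = record
      { to      = Φ
      ; from    = labelling
      ; to-∈    = λ {ℓ} ℓ-rooted → Φ-kernel ℓ (rooted⁻ ℓ ℓ-rooted)
      ; from-∈  = λ {X} X∈ker → cong₂ _∧_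
                    (invariantᵇ⁺ π (labelling X) (labelling-invariant X (proj₁ (kernelᵇ⁻ X X∈ker)) (proj₂ (kernelᵇ⁻ X X∈ker))))
                    (cong not (trans (lookup-labelling X zero) (prefixParity-zero X)))
      ; from∘to = λ {ℓ} ℓ-rooted → lookup-ext λ s →
                    trans (lookup-labelling (Φ ℓ) s) (invariant⇒prefixParity ℓ (rooted⁻ ℓ ℓ-rooted) s)
      ; to∘from = λ {X} X∈ker → Φ∘labelling X (proj₁ (kernelᵇ⁻ X X∈ker)) (proj₂ (kernelᵇ⁻ X X∈ker))
      }

    unrooted≅rooted : (λ ℓ → invariantᵇ π ℓ ∧ not (not (lookup ℓ zero))) ≅ˢ rooted
    unrooted≅rooted = record
      { to      = ∁
      ; from    = ∁
      ; to-∈    = λ {ℓ} h → cong₂ _∧_ (invariantᵇ-∁ π ℓ (proj₁ (∧-true⁻ h)))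
                               (trans (cong not (lookup-∁ ℓ zero)) (proj₂ (∧-true⁻ {invariantᵇ π ℓ} h)))
      ; from-∈  = λ {ℓ} h → cong₂ _∧_ (invariantᵇ-∁ π ℓ (proj₁ (∧-true⁻ h)))
                               (trans (cong (not ∘ not) (lookup-∁ ℓ zero)) (trans (not-involutive _) (proj₂ (∧-true⁻ {invariantᵇ π ℓ} h))))
      ; from∘to = λ {ℓ} _ → ∁-involutive ℓ
      ; to∘from = λ {ℓ} _ → ∁-involutive ℓ
      }

    #invariant≡2*#kernel : #ˢ (invariantᵇ π) ≡ #ˢ kernelᵇ + #ˢ kernelᵇ
    #invariant≡2*#kernel = trans (#ˢ-split (invariantᵇ π) (λ ℓ → not (lookup ℓ zero)))
      (cong₂ _+_ (#ˢ-cong-≅ rooted≅kernel) (trans (#ˢ-cong-≅ unrooted≅rooted) (#ˢ-cong-≅ rooted≅kernel)))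

    vertices+rank : orbits π + rankOn (intersect D) A ≡ suc (card A)
    vertices+rank = 2^-injective (begin
      2 ^ (orbits π + rankOn (intersect D) A)          ≡⟨ ^-distribˡ-+-* 2 (orbits π) _ ⟩
      2 ^ orbits π * 2 ^ rankOn (intersect D) A        ≡⟨ cong (_* 2 ^ rankOn (intersect D) A) (PermutationOrbits.#invariant≡2^orbits π π-injective) ⟨
      #ˢ (invariantᵇ π) * 2 ^ rankOn (intersect D) A   ≡⟨ cong (_* 2 ^ rankOn (intersect D) A) #invariant≡2*#kernel ⟩
      (#ˢ kernelᵇ + #ˢ kernelᵇ) * 2 ^ rankOn (intersect D) A ≡⟨ *-distribʳ-+ (2 ^ rankOn (intersect D) A) (#ˢ kernelᵇ) _ ⟩
      #ˢ kernelᵇ * 2 ^ rankOn (intersect D) A + #ˢ kernelᵇ * 2 ^ rankOn (intersect D) A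
                                                       ≡⟨ cong₂ _+_ #kernel*2^rank #kernel*2^rank ⟩
      2 ^ card A + 2 ^ card A                          ≡⟨ cong (λ x → 2 ^ card A + x) (+-identityʳ (2 ^ card A)) ⟨
      2 ^ suc (card A)                                 ∎)
      where open ≡-Reasoning

    reaches-preimage : ∀ p i → next p ≡ i → reach π partner i (2 * suc n) p ≡ true
    reaches-preimage p i next-p≡i = within-period (PermutationOrbits.period π π-injective i)
      where
      -- A helper instead of `with`, which would normalise the goal and unfold `reach` exponentially.
      within-period : (∃ λ q → 0 < q × q ≤ 2 * suc n × iter q π i ≡ i) → reach π partner i (2 * suc n) p ≡ true
      within-period (suc L , _ , L<2n , πᴸ⁺¹i≡i) = reach-mono π partner i p L<2n (one-more (lookup A (chord p)) refl)
        where
        πᴸi≡αAp : iter L π i ≡ αA p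
        πᴸi≡αAp = π-injective (trans πᴸ⁺¹i≡i (sym (trans (cong next (αA-involutive p)) next-p≡i)))
        reached : reach π partner i L (αA p) ≡ true
        reached = subst (λ q → reach π partner i L q ≡ true) πᴸi≡αAp (reach-iterate π partner i L)
        one-more : ∀ b → lookup A (chord p) ≡ b → reach π partner i (suc L) p ≡ true
        one-more false Aₚ = reach-suc π partner i L p
          (subst (λ q → reach π partner i L q ≡ true) (cong (λ b → if b then partner p else p) Aₚ) reached)
        one-more true  Aₚ = reach-step π partner i L (αA p) p reached
          (trans (cong (eqF (π (αA p)) p ∨_) (trans (cong (λ b → eqF (partner (if b then partner p else p)) p) Aₚ)
                                                    (trans (cong (λ q → eqF q p) (partner-invol p)) (eqF-refl p))))
                 (∨-zeroʳ _))

    connected : orbits₂ π partner ≡ 1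
    connected = trans (countF≡∑ least) (trans (ℕ-Sum.sum-cong-≗ (λ i → cong 𝟙 (least≡ i))) (∑-indicator {2 * suc n} zero))
      where
      least : Fin (2 * suc n) → Bool
      least i = allF (λ j → not (reach π partner i (2 * suc n) j) ∨ (toℕ i ≤ᵇ toℕ j))
      least≡ : ∀ i → least i ≡ eqF i zero
      least≡ zero    = allF-true⁺ (λ j → not (reach π partner zero (2 * suc n) j) ∨ true) (λ j → ∨-zeroʳ _)
      least≡ (suc i) = allF-false⁺ (λ j → not (reach π partner (suc i) (2 * suc n) j) ∨ (suc (toℕ i) ≤ᵇ toℕ j))
        p (cong₂ (λ r b → not r ∨ b) (reaches-preimage p (suc i) (next^-toℕ (suc i)))
                                       (trans (cong (suc (toℕ i) ≤ᵇ_) p≡i) (<ᵇ-irrefl (toℕ i))))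
        where
        p = iter (toℕ i) next zero
        p≡i : toℕ p ≡ toℕ i
        p≡i = toℕ-next^ (toℕ i) (<-trans (n<1+n (toℕ i)) (toℕ<n (suc i)))

  dual-faces : ∀ A p → PartialDual.π A (partner p) ≡ PartialDual.π (∁ A) p
  dual-faces A p rewrite partner-chord p | lookup-∁ A (chord p) with lookup A (chord p)
  ... | true  = cong next (partner-invol p)
  ... | false = refl

  invariant≅all : invariantᵇ partner ≅ˢ (λ (_ : Subset (suc n)) → true)
  invariant≅all = record
    { to      = λ ℓ → tabulate (λ d → lookup ℓ (endpoint d))
    ; from    = labels
    ; to-∈    = λ _ → refl
    ; from-∈  = λ {X} _ → invariantᵇ⁺ partner (labels X) λ p →
                  trans (lookup∘tabulate (lookup X ∘ chord) (partner p))
                        (trans (cong (lookup X) (partner-chord p)) (sym (lookup∘tabulate (lookup X ∘ chord) p)))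
    ; from∘to = λ {ℓ} inv → lookup-ext λ p →
                  trans (lookup∘tabulate (λ p → lookup (tabulate (λ d → lookup ℓ (endpoint d))) (chord p)) p)
                        (trans (lookup∘tabulate (λ d → lookup ℓ (endpoint d)) (chord p)) (same-label ℓ (invariantᵇ⁻ partner ℓ inv) p))
    ; to∘from = λ {X} _ → lookup-ext λ d →
                  trans (lookup∘tabulate (λ d → lookup (labels X) (endpoint d)) d)
                        (trans (lookup∘tabulate (lookup X ∘ chord) (endpoint d)) (cong (lookup X) (chord-endpoint d)))
    }
    where
    labels : Subset (suc n) → Subset (2 * suc n)
    labels X = tabulate (lookup X ∘ chord)
    same-label : ∀ ℓ → (∀ p → lookup ℓ (partner p) ≡ lookup ℓ p) → ∀ p → lookup ℓ (endpoint (chord p)) ≡ lookup ℓ p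
    same-label ℓ inv p with endpoints-of {p} refl
    ... | inj₁ p≡e  = cong (lookup ℓ) (sym p≡e)
    ... | inj₂ p≡e′ = trans (sym (inv (endpoint (chord p)))) (cong (lookup ℓ) (sym p≡e′))

  edges : orbits partner ≡ suc n
  edges = 2^-injective (trans (sym (PermutationOrbits.#invariant≡2^orbits partner partner-injective))
                              (trans (#ˢ-cong-≅ invariant≅all) (#ˢ-all {suc n})))

-- Euler genus

euler-genus-arithmetic : ∀ {C V E F} rA rC a c → C ≡ 1 → V + rA ≡ suc a → F + rC ≡ suc c → a + c ≡ E →
  ((+ 2) *ℤ (+ C)) -ℤ (+ V) +ℤ (+ E) -ℤ (+ F) ≡ + (rA + rC)
euler-genus-arithmetic {V = V} {E} {F} rA rC a c refl V+rA F+rC a+c = begin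
  ((+ 2) *ℤ (+ 1)) -ℤ (+ V) +ℤ (+ E) -ℤ (+ F)
    ≡⟨ rearrange (+ V) (+ F) (+ (rA + rC)) (+ E) ⟩
  + (rA + rC) +ℤ ((+ (2 + E)) -ℤ (+ (V + F + (rA + rC))))
    ≡⟨ cong (λ x → + (rA + rC) +ℤ (+ (2 + E) -ℤ + x)) vertices+faces+ranks ⟩
  + (rA + rC) +ℤ ((+ (2 + E)) -ℤ (+ (2 + E)))
    ≡⟨ cong (+ (rA + rC) +ℤ_) (ℤ.+-inverseʳ (+ (2 + E))) ⟩
  + (rA + rC) +ℤ + 0
    ≡⟨ ℤ.+-identityʳ (+ (rA + rC)) ⟩
  + (rA + rC) ∎
  where
  open ≡-Reasoning
  rearrange : ∀ (V F R E : ℤ) → ((+ 2) *ℤ (+ 1)) -ℤ V +ℤ E -ℤ F ≡ R +ℤ (((+ 2) +ℤ E) -ℤ ((V +ℤ F) +ℤ R))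
  rearrange = solve-∀
  vertices+faces+ranks : V + F + (rA + rC) ≡ 2 + E
  vertices+faces+ranks = begin
    V + F + (rA + rC)       ≡⟨ +-interchange V F rA rC ⟩
    (V + rA) + (F + rC)     ≡⟨ cong₂ _+_ V+rA F+rC ⟩
    suc a + suc c           ≡⟨ cong suc (+-suc a c) ⟩
    2 + (a + c)             ≡⟨ cong (λ x → 2 + x) a+c ⟩
    2 + E                   ∎

partialDualGenus≡rank-sum : ∀ {n} (D : ChordDiagram (suc n)) (A : Subset (suc n)) →
  partialDualGenus D A ≡ + (rankM D A + rankM D (∁ A))
partialDualGenus≡rank-sum D A =
  euler-genus-arithmetic (rankM D A) (rankM D (∁ A)) (card A) (card (∁ A)) components vertices faces edges′
  where
  -- The `+ 0`s count the isolated vertex-discs, of which there are none.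
  open ChordRibbonGraph D
  module Dᴬ = PartialDual A
  module Dᶜ = PartialDual (∁ A)
  components : orbits₂ Dᴬ.π (ChordDiagram.partner D) + 0 ≡ 1
  components = trans (+-identityʳ _) Dᴬ.connected
  vertices : orbits Dᴬ.π + 0 + rankM D A ≡ suc (card A)
  vertices = trans (cong (_+ rankM D A) (+-identityʳ _)) Dᴬ.vertices+rank
  faces : orbits (λ p → Dᴬ.π (ChordDiagram.partner D p)) + 0 + rankM D (∁ A) ≡ suc (card (∁ A))
  faces = trans (cong (_+ rankM D (∁ A)) (trans (+-identityʳ _) (orbits-cong _ Dᶜ.π (dual-faces A)))) Dᶜ.vertices+rank
  edges′ : card A + card (∁ A) ≡ orbits (ChordDiagram.partner D)
  edges′ = trans (card+card-∁ A) (sym edges)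

coeff-cong : ∀ {n} {f g : Subset n → ℤ} → (∀ A → f A ≡ g A) → ∀ k → coeff f k ≡ coeff g k
coeff-cong {n} {f} {g} f≗g k = cong length
  (filter-≐ (λ A → f A ℤ.≟ k) (λ A → g A ℤ.≟ k)
            ((λ {A} fA≡k → trans (sym (f≗g A)) fA≡k) , (λ {A} gA≡k → trans (f≗g A) gA≡k)) (allSubsets n))

theorem1p1 : ∀ (n : ℕ) (D : ChordDiagram n) (k : ℤ) →
    coeff (partialDualGenus D) k
      ≡ coeff (λ A → + (rankM D A + rankM D (∁ A))) k
theorem1p1 zero    D k = refl
theorem1p1 (suc n) D k = coeff-cong (partialDualGenus≡rank-sum D) k
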